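{- For every integer $k\ge1$, \begin{align*} &\sum_{n_k\ge n_{k-1}\ge \dots \ge n_1 \ge 1} \frac{(q;q)_{n_1}^2\,q^{n_1+n_2+\dots+n_k}}{(q^2;q^2)_{n_1}(1-q^{n_k})^2(1-q^{n_{k-1}})^2\cdots(1-q^{n_1})^2}\\ &=\sum_{n_k\ge n_{k-1}\ge \dots \ge n_1 \ge 1} \frac{q^{n_1+n_2+\dots+n_k}}{(1-q^{n_k})^2(1-q^{n_{k-1}})^2\cdots(1-q^{n_1})^2} +\sum_{n=1}^\infty \frac{2(-1)^{n}q^{n^2+kn}}{(1-q^{n})^{2k}}, \end{align*} as formal power series in $q$, where the multiple sums run over integers $n_1,\dots,n_k$.
   Context: Notation: $(a;q)_n=\prod_{j=0}^{n-1}(1-aq^j)$. -}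

module Defs where

open import Data.Nat as ℕ using (ℕ; zero; suc; _∸_)
open import Data.Nat.Divisibility using (_∣?_)
open import Data.Integer as ℤ using (ℤ; +_; 0ℤ; 1ℤ; -1ℤ)
open import Data.Bool using (if_then_else_)
open import Data.List using (List; []; _∷_; [_]; map; foldr; upTo; concatMap)
open import Relation.Nullary using (does)
open import Relation.Binary.PropositionalEquality using (_≡_)

-- Formal power series in q with integer coefficients: f N = coefficient of q^N.
FPS : Set
FPS = ℕ → ℤ

_≐_ : FPS → FPS → Set
f ≐ g = ∀ N → f N ≡ g N
infix 4 _≐_

sumUpTo : (ℕ → ℤ) → ℕ → ℤ
sumUpTo f zero    = f 0
sumUpTo f (suc N) = sumUpTo f N ℤ.+ f (suc N)

sumL : List ℤ → ℤ
sumL = foldr ℤ._+_ 0ℤ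

_⊕_ : FPS → FPS → FPS
(f ⊕ g) N = f N ℤ.+ g N
infixl 6 _⊕_

_⊗_ : FPS → FPS → FPS
(f ⊗ g) N = sumUpTo (λ i → f i ℤ.* g (N ∸ i)) N
infixl 7 _⊗_

scal : ℤ → FPS → FPS
scal c f N = c ℤ.* f N

mono : ℕ → FPS
mono m N = if does (N ℕ.≟ m) then 1ℤ else 0ℤ

oneF : FPS
oneF = mono 0

oneMinusQ : ℕ → FPS
oneMinusQ m = oneF ⊕ scal -1ℤ (mono m)

-- 1/(1 - q^m) = Σ_{j≥0} q^{m j}   (used only for m ≥ 1)
geom : ℕ → FPS
geom m N = if does (m ∣? N) then 1ℤ else 0ℤ

prodL : List FPS → FPS
prodL = foldr _⊗_ oneF

powF : FPS → ℕ → FPS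
powF f zero    = oneF
powF f (suc k) = f ⊗ powF f k

poch : ℕ → ℕ → ℕ → FPS
poch a b n = prodL (map (λ j → oneMinusQ (a ℕ.+ b ℕ.* j)) (upTo n))

-- 1/(q^a ; q^b)_n  (a ≥ 1)
invPoch : ℕ → ℕ → ℕ → FPS
invPoch a b n = prodL (map (λ j → geom (a ℕ.+ b ℕ.* j)) (upTo n))

range : ℕ → ℕ → List ℕ
range lo N = map (lo ℕ.+_) (upTo (suc N ∸ lo))

chains : ℕ → ℕ → ℕ → List (List ℕ)
chains zero    lo N = [ [] ]
chains (suc k) lo N = concatMap (λ n → map (n ∷_) (chains k n N)) (range lo N)

-- Each summand used below is divisible by q^{n₁+...+n_k}, so chains with
-- some entry > N contribute nothing to the coefficient of q^N; the
-- coefficient of q^N of the (formally convergent) infinite sum is thus the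
-- finite sum over chains with entries ≤ N.
multiSum : ℕ → (List ℕ → FPS) → FPS
multiSum k T N = sumL (map (λ c → T c N) (chains k 1 N))

-- Σ_{n ≥ 1} F n, for families with F n divisible by q^n (formally convergent).
infSum : (ℕ → FPS) → FPS
infSum F N = sumL (map (λ n → F n N) (range 1 N))

qFactor : ℕ → FPS
qFactor n = mono n ⊗ geom n ⊗ geom n

rhsTerm : List ℕ → FPS
rhsTerm ns = prodL (map qFactor ns)

lhsTerm : List ℕ → FPS
lhsTerm []         = oneF
lhsTerm (n₁ ∷ ns) =
  poch 1 1 n₁ ⊗ poch 1 1 n₁ ⊗ invPoch 2 2 n₁ ⊗ rhsTerm (n₁ ∷ ns)

thetaTerm : ℕ → ℕ → FPS
thetaTerm k n =
  scal (+ 2 ℤ.* (-1ℤ ℤ.^ n)) (mono (n ℕ.* n ℕ.+ k ℕ.* n) ⊗ powF (geom n) (2 ℕ.* k))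

module Submission where

-- Fix N; only chains with entries ≤ N matter.
--  (1) By a WZ-type telescoping argument,
--        1/(q²;q²)_n = Σ_{|j|≤n} (-1)^j q^{j²} / ((q;q)_{n-j} (q;q)_{n+j}),
--      hence (q;q)_n²/(q²;q²)_n = 1 + Σ_{j≥1} 2(-1)^j q^{j²} f_j(n) with
--      f_j(n) = (q;q)_n² / ((q;q)_{n-j} (q;q)_{n+j}).
--  (2) f_j satisfies  f_j(n) q^n/(1-q^n)² = a_j (f_j(n) - f_j(n-1)),
--      a_j = q^j/(1-q^j)², and f_j(0) = 0.
--  (3) Abel summation over chains turns such a recurrence into
--      Σ_chains f(n₁) Π q^{nᵢ}/(1-q^{nᵢ})² = a^k f(N).
--  (4) f_j(N) ≡ 1 mod q^{N-j+1}, so 2(-1)^j q^{j²} a_j^k f_j(N) agrees with the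
--      j-th theta term up to q^N.

open import Defs
open import Data.Nat using (ℕ; _≤_)

open import Data.Nat as ℕ using (zero; suc; _∸_; z≤n; s≤s)
import Data.Nat.Properties as NP
open import Data.Nat.Divisibility using (_∣_; _∣?_; ∣m+n∣m⇒∣n; ∣m∸n∣n⇒∣m; >⇒∤; ∣-refl; divides)
open import Data.Nat.Tactic.RingSolver using (solve-∀)
open import Data.Integer as ℤ using (ℤ; 0ℤ; 1ℤ; -1ℤ)
import Data.Integer.Properties as ZP
open import Algebra.Properties.CommutativeSemigroup ZP.+-commutativeSemigroup
  using () renaming (interchange to ℤ-interchange)
open import Data.Bool using (if_then_else_)
open import Data.Maybe using (Maybe; just; nothing)
open import Data.Product using (_,_; _×_)
open import Data.List using (List; []; _∷_; [_]; map; upTo; applyUpTo; concatMap; _++_)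
import Data.List.Properties as LP
open import Data.List.Relation.Unary.All as All using (All; []; _∷_)
open import Relation.Nullary using (Dec; does; yes; no; ¬_)
open import Relation.Nullary.Decidable using (dec-true; dec-false)
open import Relation.Binary.Definitions using (tri<; tri≈; tri>)
open import Relation.Binary.PropositionalEquality hiding ([_])
open import Level using (0ℓ)
open import Algebra.Bundles using (CommutativeRing)
import Algebra.Solver.Ring
import Algebra.Solver.Ring.AlmostCommutativeRing as ACR
import Relation.Binary.Reasoning.Setoid as SetoidReasoning

sum-cong : ∀ {f g : ℕ → ℤ} N → (∀ i → i ℕ.≤ N → f i ≡ g i) →
           sumUpTo f N ≡ sumUpTo g N
sum-cong zero    h = h 0 z≤n
sum-cong (suc N) h =
  cong₂ ℤ._+_ (sum-cong N (λ i i≤N → h i (NP.m≤n⇒m≤1+n i≤N))) (h (suc N) NP.≤-refl)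

sum-+ : ∀ (f g : ℕ → ℤ) N →
        sumUpTo (λ i → f i ℤ.+ g i) N ≡ sumUpTo f N ℤ.+ sumUpTo g N
sum-+ f g zero    = refl
sum-+ f g (suc N) =
  trans (cong (ℤ._+ (f (suc N) ℤ.+ g (suc N))) (sum-+ f g N))
        (ℤ-interchange (sumUpTo f N) (sumUpTo g N) (f (suc N)) (g (suc N)))

sum-*ˡ : ∀ c (f : ℕ → ℤ) N → sumUpTo (λ i → c ℤ.* f i) N ≡ c ℤ.* sumUpTo f N
sum-*ˡ c f zero    = refl
sum-*ˡ c f (suc N) =
  trans (cong (ℤ._+ c ℤ.* f (suc N)) (sum-*ˡ c f N))
        (sym (ZP.*-distribˡ-+ c (sumUpTo f N) (f (suc N))))

sum-*ʳ : ∀ c (f : ℕ → ℤ) N → sumUpTo (λ i → f i ℤ.* c) N ≡ sumUpTo f N ℤ.* c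
sum-*ʳ c f N = begin
  sumUpTo (λ i → f i ℤ.* c) N ≡⟨ sum-cong N (λ i _ → ZP.*-comm (f i) c) ⟩
  sumUpTo (λ i → c ℤ.* f i) N ≡⟨ sum-*ˡ c f N ⟩
  c ℤ.* sumUpTo f N           ≡⟨ ZP.*-comm c (sumUpTo f N) ⟩
  sumUpTo f N ℤ.* c           ∎
  where open ≡-Reasoning

sum-zero : ∀ (f : ℕ → ℤ) N → (∀ i → i ℕ.≤ N → f i ≡ 0ℤ) → sumUpTo f N ≡ 0ℤ
sum-zero f N h = trans (sum-cong N h) (zeros N)
  where
  zeros : ∀ N → sumUpTo (λ _ → 0ℤ) N ≡ 0ℤ
  zeros zero    = refl
  zeros (suc N) = cong (ℤ._+ 0ℤ) (zeros N)

sum-shift : ∀ (f : ℕ → ℤ) N →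
            sumUpTo f (suc N) ≡ f 0 ℤ.+ sumUpTo (λ i → f (suc i)) N
sum-shift f zero    = refl
sum-shift f (suc N) =
  trans (cong (ℤ._+ f (suc (suc N))) (sum-shift f N)) (ZP.+-assoc (f 0) _ _)

sum-reverse : ∀ (f : ℕ → ℤ) N → sumUpTo f N ≡ sumUpTo (λ i → f (N ∸ i)) N
sum-reverse f zero    = refl
sum-reverse f (suc N) = begin
  sumUpTo f N ℤ.+ f (suc N)                 ≡⟨ cong (ℤ._+ f (suc N)) (sum-reverse f N) ⟩
  sumUpTo (λ i → f (N ∸ i)) N ℤ.+ f (suc N) ≡⟨ ZP.+-comm _ (f (suc N)) ⟩
  f (suc N) ℤ.+ sumUpTo (λ i → f (N ∸ i)) N ≡⟨ sum-shift (λ i → f (suc N ∸ i)) N ⟨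
  sumUpTo (λ i → f (suc N ∸ i)) (suc N)     ∎
  where open ≡-Reasoning

sum-swap : ∀ (F : ℕ → ℕ → ℤ) N →
  sumUpTo (λ i → sumUpTo (F i) i) N ≡
  sumUpTo (λ j → sumUpTo (λ t → F (j ℕ.+ t) j) (N ∸ j)) N
sum-swap F zero    = refl
sum-swap F (suc N) = begin
  sumUpTo (λ i → sumUpTo (F i) i) N ℤ.+ sumUpTo (F (suc N)) (suc N)
    ≡⟨ cong (ℤ._+ sumUpTo (F (suc N)) (suc N)) (sum-swap F N) ⟩
  Columns N ℤ.+ (sumUpTo (F (suc N)) N ℤ.+ F (suc N) (suc N))
    ≡⟨ ZP.+-assoc (Columns N) _ _ ⟨
  (Columns N ℤ.+ sumUpTo (F (suc N)) N) ℤ.+ F (suc N) (suc N)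
    ≡⟨ cong (ℤ._+ F (suc N) (suc N)) (sum-+ _ _ N) ⟨
  sumUpTo (λ j → column N j ℤ.+ F (suc N) j) N ℤ.+ F (suc N) (suc N)
    ≡⟨ cong₂ ℤ._+_ (sum-cong N extend) (cong (λ x → F x (suc N)) (sym (NP.+-identityʳ (suc N)))) ⟩
  sumUpTo (column (suc N)) N ℤ.+ F (suc N ℕ.+ 0) (suc N)
    ≡⟨ cong (λ x → sumUpTo (column (suc N)) N ℤ.+ sumUpTo (λ t → F (suc N ℕ.+ t) (suc N)) x)
            (NP.n∸n≡0 (suc N)) ⟨
  Columns (suc N) ∎
  where
  open ≡-Reasoning
  column : ℕ → ℕ → ℤ
  column N j = sumUpTo (λ t → F (j ℕ.+ t) j) (N ∸ j)
  Columns : ℕ → ℤ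
  Columns N = sumUpTo (column N) N
  extend : ∀ j → j ℕ.≤ N → column N j ℤ.+ F (suc N) j ≡ column (suc N) j
  extend j j≤N = begin
    column N j ℤ.+ F (suc N) j
      ≡⟨ cong (λ x → column N j ℤ.+ F x j)
              (trans (cong suc (sym (NP.m+[n∸m]≡n j≤N))) (sym (NP.+-suc j (N ∸ j)))) ⟩
    sumUpTo (λ t → F (j ℕ.+ t) j) (suc (N ∸ j))
      ≡⟨ cong (sumUpTo (λ t → F (j ℕ.+ t) j)) (NP.+-∸-assoc 1 j≤N) ⟨
    column (suc N) j ∎

if-yes : ∀ {A P : Set} (d : Dec P) (x y : A) → P → (if does d then x else y) ≡ x
if-yes d x y p = cong (λ b → if b then x else y) (dec-true d p)

if-no : ∀ {A P : Set} (d : Dec P) (x y : A) → ¬ P → (if does d then x else y) ≡ y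
if-no d x y ¬p = cong (λ b → if b then x else y) (dec-false d ¬p)

mono-≢ : ∀ a i → i ≢ a → mono a i ≡ 0ℤ
mono-≢ a i i≢a = if-no (i ℕ.≟ a) 1ℤ 0ℤ i≢a

mono-≡ : ∀ a → mono a a ≡ 1ℤ
mono-≡ a = if-yes (a ℕ.≟ a) 1ℤ 0ℤ refl

mono-<-zero : ∀ a i → i ℕ.< a → mono a i ≡ 0ℤ
mono-<-zero a i i<a = mono-≢ a i (λ i≡a → NP.<-irrefl i≡a i<a)

delta-sum-out : ∀ a (h : ℕ → ℤ) N → N ℕ.< a → sumUpTo (λ i → mono a i ℤ.* h i) N ≡ 0ℤ
delta-sum-out a h N N<a = sum-zero _ N (λ i i≤N →
  trans (cong (ℤ._* h i) (mono-<-zero a i (NP.≤-<-trans i≤N N<a))) (ZP.*-zeroˡ (h i)))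

delta-sum : ∀ a (h : ℕ → ℤ) N → a ℕ.≤ N → sumUpTo (λ i → mono a i ℤ.* h i) N ≡ h a
delta-sum .0 h zero z≤n = trans (cong (ℤ._* h 0) (mono-≡ 0)) (ZP.*-identityˡ (h 0))
delta-sum a h (suc N) a≤1+N with a ℕ.≟ suc N
... | yes refl = begin
  sumUpTo (λ i → mono (suc N) i ℤ.* h i) N ℤ.+ mono (suc N) (suc N) ℤ.* h (suc N)
    ≡⟨ cong₂ ℤ._+_ (delta-sum-out (suc N) h N NP.≤-refl) (cong (ℤ._* h (suc N)) (mono-≡ (suc N))) ⟩
  0ℤ ℤ.+ 1ℤ ℤ.* h (suc N)
    ≡⟨ trans (ZP.+-identityˡ _) (ZP.*-identityˡ (h (suc N))) ⟩
  h (suc N) ∎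
  where open ≡-Reasoning
... | no a≢1+N = begin
  sumUpTo (λ i → mono a i ℤ.* h i) N ℤ.+ mono a (suc N) ℤ.* h (suc N)
    ≡⟨ cong₂ ℤ._+_ (delta-sum a h N (NP.≤-pred (NP.≤∧≢⇒< a≤1+N a≢1+N)))
                   (cong (ℤ._* h (suc N)) (mono-≢ a (suc N) (λ e → a≢1+N (sym e)))) ⟩
  h a ℤ.+ 0ℤ ℤ.* h (suc N)
    ≡⟨ trans (cong (λ x → h a ℤ.+ x) (ZP.*-zeroˡ (h (suc N)))) (ZP.+-identityʳ (h a)) ⟩
  h a ∎
  where open ≡-Reasoning

⊗-cong : ∀ {f f′ g g′} → f ≐ f′ → g ≐ g′ → f ⊗ g ≐ f′ ⊗ g′
⊗-cong f≐f′ g≐g′ N = sum-cong N (λ i _ → cong₂ ℤ._*_ (f≐f′ i) (g≐g′ (N ∸ i)))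

⊗-comm : ∀ f g → f ⊗ g ≐ g ⊗ f
⊗-comm f g N = begin
  sumUpTo (λ i → f i ℤ.* g (N ∸ i)) N             ≡⟨ sum-reverse _ N ⟩
  sumUpTo (λ i → f (N ∸ i) ℤ.* g (N ∸ (N ∸ i))) N ≡⟨ sum-cong N swap ⟩
  sumUpTo (λ i → g i ℤ.* f (N ∸ i)) N             ∎
  where
  open ≡-Reasoning
  swap : ∀ i → i ℕ.≤ N → f (N ∸ i) ℤ.* g (N ∸ (N ∸ i)) ≡ g i ℤ.* f (N ∸ i)
  swap i i≤N = trans (cong (λ x → f (N ∸ i) ℤ.* g x) (NP.m∸[m∸n]≡n i≤N))
                     (ZP.*-comm (f (N ∸ i)) (g i))

⊗-assoc : ∀ f g h → (f ⊗ g) ⊗ h ≐ f ⊗ (g ⊗ h)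
⊗-assoc f g h N = begin
  sumUpTo (λ i → sumUpTo (λ j → f j ℤ.* g (i ∸ j)) i ℤ.* h (N ∸ i)) N
    ≡⟨ sum-cong N (λ i _ → sum-*ʳ (h (N ∸ i)) (λ j → f j ℤ.* g (i ∸ j)) i) ⟨
  sumUpTo (λ i → sumUpTo (λ j → f j ℤ.* g (i ∸ j) ℤ.* h (N ∸ i)) i) N
    ≡⟨ sum-swap (λ i j → f j ℤ.* g (i ∸ j) ℤ.* h (N ∸ i)) N ⟩
  sumUpTo (λ j → sumUpTo (λ t → f j ℤ.* g (j ℕ.+ t ∸ j) ℤ.* h (N ∸ (j ℕ.+ t))) (N ∸ j)) N
    ≡⟨ sum-cong N (λ j _ → trans (sum-cong (N ∸ j) (λ t _ → reindex j t)) (sum-*ˡ (f j) _ (N ∸ j))) ⟩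
  sumUpTo (λ j → f j ℤ.* sumUpTo (λ t → g t ℤ.* h (N ∸ j ∸ t)) (N ∸ j)) N ∎
  where
  open ≡-Reasoning
  reindex : ∀ j t → f j ℤ.* g (j ℕ.+ t ∸ j) ℤ.* h (N ∸ (j ℕ.+ t)) ≡ f j ℤ.* (g t ℤ.* h (N ∸ j ∸ t))
  reindex j t = trans (cong₂ (λ x y → f j ℤ.* g x ℤ.* h y) (NP.m+n∸m≡n j t) (sym (NP.∸-+-assoc N j t)))
                      (ZP.*-assoc (f j) _ _)

⊗-identityˡ : ∀ f → oneF ⊗ f ≐ f
⊗-identityˡ f N = delta-sum 0 (λ i → f (N ∸ i)) N z≤n

⊗-distribˡ : ∀ f g h → f ⊗ (g ⊕ h) ≐ (f ⊗ g) ⊕ (f ⊗ h)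
⊗-distribˡ f g h N =
  trans (sum-cong N (λ i _ → ZP.*-distribˡ-+ (f i) (g (N ∸ i)) (h (N ∸ i)))) (sum-+ _ _ N)

zeroF : FPS
zeroF _ = 0ℤ

negF : FPS → FPS
negF f N = ℤ.- f N

-- Coefficientwise equality wrapped in a record, so that Agda can infer the
-- two series from a proof (a bare `f ≐ g` is a function type and is not
-- injective in f and g); this is the equality of the ring below.
record _≋_ (f g : FPS) : Set where
  constructor mk
  field get : f ≐ g
open _≋_ public
infix 4 _≋_

FPS-ring : CommutativeRing 0ℓ 0ℓ
FPS-ring = record
  { Carrier = FPS ; _≈_ = _≋_ ; _+_ = _⊕_ ; _*_ = _⊗_ ; -_ = negF ; 0# = zeroF ; 1# = oneF
  ; isCommutativeRing = record
    { isRing = record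
      { +-isAbelianGroup = record
        { isGroup = record
          { isMonoid = record
            { isSemigroup = record
              { isMagma = record
                { isEquivalence = record
                  { refl  = mk (λ N → refl)
                  ; sym   = λ p → mk (λ N → sym (get p N))
                  ; trans = λ p q → mk (λ N → trans (get p N) (get q N)) }
                ; ∙-cong = λ p q → mk (λ N → cong₂ ℤ._+_ (get p N) (get q N)) }
              ; assoc = λ f g h → mk (λ N → ZP.+-assoc (f N) (g N) (h N)) }
            ; identity = (λ f → mk (λ N → ZP.+-identityˡ (f N)))
                       , (λ f → mk (λ N → ZP.+-identityʳ (f N))) }
          ; inverse = (λ f → mk (λ N → ZP.+-inverseˡ (f N)))
                    , (λ f → mk (λ N → ZP.+-inverseʳ (f N)))
          ; ⁻¹-cong = λ p → mk (λ N → cong ℤ.-_ (get p N)) }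
        ; comm = λ f g → mk (λ N → ZP.+-comm (f N) (g N)) }
      ; *-cong = λ p q → mk (⊗-cong (get p) (get q))
      ; *-assoc = λ f g h → mk (⊗-assoc f g h)
      ; *-identity = (λ f → mk (⊗-identityˡ f))
                   , (λ f → mk (λ N → trans (⊗-comm f oneF N) (⊗-identityˡ f N)))
      ; distrib = (λ f g h → mk (⊗-distribˡ f g h))
                , (λ f g h → mk (λ N → trans (⊗-comm (g ⊕ h) f N)
                     (trans (⊗-distribˡ f g h N) (cong₂ ℤ._+_ (⊗-comm f g N) (⊗-comm f h N))))) }
    ; *-comm = λ f g → mk (⊗-comm f g) } }

open CommutativeRing FPS-ring public
  using (_+_; _*_; -_; _-_; 0#; 1#; _≈_; +-cong; *-cong; -‿cong;
         +-assoc; +-identityˡ; +-identityʳ; distribˡ; distribʳ;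
         *-assoc; *-comm; *-identityˡ; *-identityʳ; zeroʳ; -‿inverseʳ; +-commutativeSemigroup)
  renaming (refl to ≈-refl; sym to ≈-sym; trans to ≈-trans; setoid to FPS-setoid)

open import Algebra.Properties.CommutativeSemigroup +-commutativeSemigroup
  using () renaming (interchange to +-interchange)

≡⇒≈ : ∀ {f g} → f ≡ g → f ≈ g
≡⇒≈ refl = ≈-refl

scal-⊗ˡ : ∀ c f g → scal c f ⊗ g ≐ scal c (f ⊗ g)
scal-⊗ˡ c f g N = trans (sum-cong N (λ i _ → ZP.*-assoc c (f i) (g (N ∸ i)))) (sum-*ˡ c _ N)

scal≈* : ∀ c f → scal c f ≈ scal c oneF * f
scal≈* c f = mk (λ N → sym (trans (scal-⊗ˡ c oneF f N) (cong (c ℤ.*_) (⊗-identityˡ f N))))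

-- The constant series c, defined so that constF 0ℤ and constF 1ℤ are
-- definitionally 0# and 1# (the ring solver below relies on this).
constF : ℤ → FPS
constF (ℤ.+ zero) N = 0ℤ
constF c          N = if does (N ℕ.≟ 0) then c else 0ℤ

constF≈scal : ∀ c → constF c ≈ scal c oneF
constF≈scal c = mk (coefficient c)
  where
  coefficient : ∀ c N → constF c N ≡ c ℤ.* oneF N
  coefficient (ℤ.+ zero)    N       = sym (ZP.*-zeroˡ (oneF N))
  coefficient c@(ℤ.+ suc _) zero    = sym (ZP.*-identityʳ c)
  coefficient c@(ℤ.+ suc _) (suc N) = sym (ZP.*-zeroʳ c)
  coefficient c@(ℤ.-[1+ _ ])zero    = sym (ZP.*-identityʳ c)
  coefficient c@(ℤ.-[1+ _ ])(suc N) = sym (ZP.*-zeroʳ c)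

scal≈constF* : ∀ c f → scal c f ≈ constF c * f
scal≈constF* c f = ≈-trans (scal≈* c f) (*-cong (≈-sym (constF≈scal c)) (≈-refl {f}))

-- constF is a ring homomorphism from ℤ, which lets the ring solver work
-- with integer coefficients (whose equality is decidable).
constF-hom : CommutativeRing.rawRing ZP.+-*-commutativeRing
             ACR.-Raw-AlmostCommutative⟶ ACR.fromCommutativeRing FPS-ring
constF-hom = record
  { ⟦_⟧    = constF
  ; +-homo = λ c d → via-scal (c ℤ.+ d) (constF c + constF d)
      (≈-trans (mk (λ N → ZP.*-distribʳ-+ (oneF N) c d)) (+-cong (≈-sym (constF≈scal c)) (≈-sym (constF≈scal d))))
  ; *-homo = λ c d → via-scal (c ℤ.* d) (constF c * constF d)
      (≈-trans (mk (λ N → trans (ZP.*-assoc c d (oneF N)) (cong (c ℤ.*_) (sym (get (constF≈scal d) N)))))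
               (scal≈constF* c (constF d)))
  ; -‿homo = λ c → via-scal (ℤ.- c) (- constF c)
      (≈-trans (mk (λ N → sym (ZP.neg-distribˡ-* c (oneF N)))) (-‿cong (≈-sym (constF≈scal c))))
  ; 0-homo = ≈-refl
  ; 1-homo = ≈-refl }
  where
  via-scal : ∀ c f → scal c oneF ≈ f → constF c ≈ f
  via-scal c f = ≈-trans (constF≈scal c)

coeff-equal? : ∀ c d → Maybe (constF c ≈ constF d)
coeff-equal? c d with c ℤ.≟ d
... | yes refl = just ≈-refl
... | no _     = nothing

module FPS-Solver =
  Algebra.Solver.Ring (CommutativeRing.rawRing ZP.+-*-commutativeRing)
                      (ACR.fromCommutativeRing FPS-ring) constF-hom coeff-equal?
open FPS-Solver using (solve; _:=_; con; _:+_; _:*_; _:-_; :-_)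

mono-shift : ∀ a f N → a ℕ.≤ N → (mono a ⊗ f) N ≡ f (N ∸ a)
mono-shift a f N a≤N = delta-sum a (λ i → f (N ∸ i)) N a≤N

mono-shift-out : ∀ a f N → N ℕ.< a → (mono a ⊗ f) N ≡ 0ℤ
mono-shift-out a f N N<a = delta-sum-out a (λ i → f (N ∸ i)) N N<a

mono-+ : ∀ a b → mono a * mono b ≈ mono (a ℕ.+ b)
mono-+ a b = mk coefficient
  where
  coefficient : ∀ N → (mono a ⊗ mono b) N ≡ mono (a ℕ.+ b) N
  coefficient N with a ℕ.≤? N
  ... | no a≰N = trans (mono-shift-out a (mono b) N (NP.≰⇒> a≰N))
    (sym (mono-≢ (a ℕ.+ b) N (λ N≡a+b → a≰N (NP.≤-trans (NP.m≤m+n a b) (NP.≤-reflexive (sym N≡a+b))))))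
  ... | yes a≤N with N ∸ a ℕ.≟ b
  ...   | yes N-a≡b = trans (mono-shift a (mono b) N a≤N) (trans (cong (mono b) N-a≡b)
    (trans (mono-≡ b) (sym (trans (cong (mono (a ℕ.+ b))
      (trans (sym (NP.m+[n∸m]≡n a≤N)) (cong (a ℕ.+_) N-a≡b))) (mono-≡ (a ℕ.+ b))))))
  ...   | no N-a≢b = trans (mono-shift a (mono b) N a≤N) (trans (mono-≢ b (N ∸ a) N-a≢b)
    (sym (mono-≢ (a ℕ.+ b) N (λ N≡a+b → N-a≢b (trans (cong (_∸ a) N≡a+b) (NP.m+n∸m≡n a b))))))

-- A convenient form of mono-+ when the exponent is only propositionally a sum.
mono-split : ∀ a b m → m ≡ a ℕ.+ b → mono m ≈ mono a * mono b
mono-split a b m refl = ≈-sym (mono-+ a b)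

oneMinusQ≈ : ∀ n → oneMinusQ n ≈ 1# - mono n
oneMinusQ≈ n = mk (λ N → cong (λ z → oneF N ℤ.+ z) (ZP.-1*i≡-i (mono n N)))

geom-∣ : ∀ n N → n ∣ N → geom n N ≡ 1ℤ
geom-∣ n N n∣N = if-yes (n ∣? N) 1ℤ 0ℤ n∣N

geom-∤ : ∀ n N → ¬ (n ∣ N) → geom n N ≡ 0ℤ
geom-∤ n N n∤N = if-no (n ∣? N) 1ℤ 0ℤ n∤N

geom-periodic : ∀ n N → n ℕ.≤ N → geom n N ≡ geom n (N ∸ n)
geom-periodic n N n≤N with n ∣? N
... | yes n∣N = sym (geom-∣ n (N ∸ n) (∣m+n∣m⇒∣n (subst (n ∣_) (sym (NP.m+[n∸m]≡n n≤N)) n∣N) ∣-refl))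
... | no n∤N  = sym (geom-∤ n (N ∸ n) (λ n∣N-n → n∤N (∣m∸n∣n⇒∣m n n≤N n∣N-n ∣-refl)))

geom-below : ∀ n N → N ℕ.< n → geom n N ≡ oneF N
geom-below n zero    _   = geom-∣ n 0 (divides 0 refl)
geom-below n (suc N) N<n = geom-∤ n (suc N) (>⇒∤ N<n)

-- (1 - q^n) · 1/(1-q^n) = 1 for n ≥ 1, checked coefficientwise: the
-- coefficient of q^N is  g(N) - g(N-n)  with g = geom n.
oneMinusQ-geom : ∀ n → 1 ℕ.≤ n → oneMinusQ n * geom n ≈ 1#
oneMinusQ-geom n 1≤n = ≈-trans (distribʳ (geom n) oneF (scal -1ℤ (mono n)))
  (mk (λ N → trans (cong₂ ℤ._+_ (⊗-identityˡ (geom n) N) (scal-⊗ˡ -1ℤ (mono n) (geom n) N))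
                   (coefficient N)))
  where
  coefficient : ∀ N → geom n N ℤ.+ -1ℤ ℤ.* (mono n ⊗ geom n) N ≡ oneF N
  coefficient N with n ℕ.≤? N
  ... | yes n≤N = begin
    geom n N ℤ.+ -1ℤ ℤ.* (mono n ⊗ geom n) N
      ≡⟨ cong₂ (λ x y → x ℤ.+ -1ℤ ℤ.* y) (geom-periodic n N n≤N) (mono-shift n (geom n) N n≤N) ⟩
    geom n (N ∸ n) ℤ.+ -1ℤ ℤ.* geom n (N ∸ n)
      ≡⟨ cong (λ x → geom n (N ∸ n) ℤ.+ x) (ZP.-1*i≡-i (geom n (N ∸ n))) ⟩
    geom n (N ∸ n) ℤ.+ ℤ.- geom n (N ∸ n)
      ≡⟨ ZP.+-inverseʳ (geom n (N ∸ n)) ⟩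
    0ℤ
      ≡⟨ mono-≢ 0 N (λ N≡0 → NP.<-irrefl (sym N≡0) (NP.<-≤-trans 1≤n n≤N)) ⟨
    oneF N ∎
    where open ≡-Reasoning
  ... | no n≰N = trans (cong (λ y → geom n N ℤ.+ -1ℤ ℤ.* y) (mono-shift-out n (geom n) N (NP.≰⇒> n≰N)))
                       (trans (ZP.+-identityʳ (geom n N)) (geom-below n N (NP.≰⇒> n≰N)))

geom-inverse : ∀ n → 1 ℕ.≤ n → geom n * (1# - mono n) ≈ 1#
geom-inverse n 1≤n =
  ≈-trans (*-comm (geom n) (1# - mono n))
          (≈-trans (*-cong (≈-sym (oneMinusQ≈ n)) (≈-refl {geom n})) (oneMinusQ-geom n 1≤n))

OrderAtLeast : ℕ → FPS → Set
OrderAtLeast v f = ∀ i → i ℕ.< v → f i ≡ 0ℤ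

order-* : ∀ {a b f g} → OrderAtLeast a f → OrderAtLeast b g → OrderAtLeast (a ℕ.+ b) (f * g)
order-* {a} {b} {f} {g} ord-f ord-g i i<a+b = sum-zero _ i vanishes
  where
  vanishes : ∀ t → t ℕ.≤ i → f t ℤ.* g (i ∸ t) ≡ 0ℤ
  vanishes t t≤i with t ℕ.<? a
  ... | yes t<a = trans (cong (ℤ._* g (i ∸ t)) (ord-f t t<a)) (ZP.*-zeroˡ (g (i ∸ t)))
  ... | no t≮a  = trans (cong (f t ℤ.*_) (ord-g (i ∸ t) i-t<b)) (ZP.*-zeroʳ (f t))
    where
    i-t<b : i ∸ t ℕ.< b
    i-t<b = NP.+-cancelˡ-< t (i ∸ t) b (subst (ℕ._< t ℕ.+ b) (sym (NP.m+[n∸m]≡n t≤i))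
              (NP.<-≤-trans i<a+b (NP.+-monoˡ-≤ b (NP.≮⇒≥ t≮a))))

order-*ʳ : ∀ {b} f {g} → OrderAtLeast b g → OrderAtLeast b (f * g)
order-*ʳ f ord-g = order-* {0} {f = f} (λ _ ()) ord-g

order-*ˡ : ∀ {a f} g → OrderAtLeast a f → OrderAtLeast a (f * g)
order-*ˡ {a} {f} g ord-f i i<a =
  order-* {a} {0} {f} {g} ord-f (λ _ ()) i (subst (i ℕ.<_) (sym (NP.+-identityʳ a)) i<a)

order-+ : ∀ {v f g} → OrderAtLeast v f → OrderAtLeast v g → OrderAtLeast v (f + g)
order-+ ord-f ord-g i i<v = cong₂ ℤ._+_ (ord-f i i<v) (ord-g i i<v)

order-neg : ∀ {v f} → OrderAtLeast v f → OrderAtLeast v (- f)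
order-neg ord-f i i<v = cong ℤ.-_ (ord-f i i<v)

order-mono : ∀ n → OrderAtLeast n (mono n)
order-mono n = mono-<-zero n

order-weaken : ∀ {v w f} → w ℕ.≤ v → OrderAtLeast v f → OrderAtLeast w f
order-weaken w≤v ord-f i i<w = ord-f i (NP.<-≤-trans i<w w≤v)

order-cong : ∀ {v f g} → f ≈ g → OrderAtLeast v f → OrderAtLeast v g
order-cong f≈g ord-f i i<v = trans (sym (get f≈g i)) (ord-f i i<v)

ΣL : ∀ {A : Set} → (A → FPS) → List A → FPS
ΣL h []       = 0#
ΣL h (x ∷ xs) = h x + ΣL h xs

ΣL-coefficient : ∀ {A : Set} (h : A → FPS) xs N → ΣL h xs N ≡ sumL (map (λ a → h a N) xs)
ΣL-coefficient h []       N = refl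
ΣL-coefficient h (x ∷ xs) N = cong (λ z → h x N ℤ.+ z) (ΣL-coefficient h xs N)

ΣL-cong : ∀ {A : Set} {h h′ : A → FPS} xs → (∀ a → h a ≈ h′ a) → ΣL h xs ≈ ΣL h′ xs
ΣL-cong []       h≈h′ = ≈-refl
ΣL-cong (x ∷ xs) h≈h′ = +-cong (h≈h′ x) (ΣL-cong xs h≈h′)

ΣL-congAll : ∀ {A : Set} {h h′ : A → FPS} {xs} → All (λ a → h a ≈ h′ a) xs → ΣL h xs ≈ ΣL h′ xs
ΣL-congAll []           = ≈-refl
ΣL-congAll (h≈h′ ∷ all) = +-cong h≈h′ (ΣL-congAll all)

ΣL-++ : ∀ {A : Set} (h : A → FPS) xs ys → ΣL h (xs ++ ys) ≈ ΣL h xs + ΣL h ys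
ΣL-++ h []       ys = ≈-sym (+-identityˡ (ΣL h ys))
ΣL-++ h (x ∷ xs) ys = ≈-trans (+-cong (≈-refl {h x}) (ΣL-++ h xs ys)) (≈-sym (+-assoc (h x) _ _))

ΣL-map : ∀ {A B : Set} (h : B → FPS) (g : A → B) xs → ΣL h (map g xs) ≡ ΣL (λ a → h (g a)) xs
ΣL-map h g []       = refl
ΣL-map h g (x ∷ xs) = cong (h (g x) +_) (ΣL-map h g xs)

ΣL-concatMap : ∀ {A B : Set} (h : B → FPS) (g : A → List B) xs →
               ΣL h (concatMap g xs) ≈ ΣL (λ a → ΣL h (g a)) xs
ΣL-concatMap h g []       = ≈-refl
ΣL-concatMap h g (x ∷ xs) = ≈-trans (ΣL-++ h (g x) (concatMap g xs)) (+-cong (≈-refl {ΣL h (g x)}) (ΣL-concatMap h g xs))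

ΣL-+ : ∀ {A : Set} (h h′ : A → FPS) xs → ΣL (λ a → h a + h′ a) xs ≈ ΣL h xs + ΣL h′ xs
ΣL-+ h h′ []       = ≈-sym (+-identityˡ 0#)
ΣL-+ h h′ (x ∷ xs) = ≈-trans (+-cong (≈-refl {h x + h′ x}) (ΣL-+ h h′ xs)) (+-interchange (h x) (h′ x) _ _)

ΣL-*ˡ : ∀ {A : Set} (c : FPS) (h : A → FPS) xs → c * ΣL h xs ≈ ΣL (λ a → c * h a) xs
ΣL-*ˡ c h []       = zeroʳ c
ΣL-*ˡ c h (x ∷ xs) = ≈-trans (distribˡ c (h x) (ΣL h xs)) (+-cong (≈-refl {c * h x}) (ΣL-*ˡ c h xs))

ΣL-*ʳ : ∀ {A : Set} (c : FPS) (h : A → FPS) xs → ΣL h xs * c ≈ ΣL (λ a → h a * c) xs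
ΣL-*ʳ c h xs = ≈-trans (*-comm (ΣL h xs) c)
  (≈-trans (ΣL-*ˡ c h xs) (ΣL-cong xs (λ a → *-comm c (h a))))

ΣL-zero : ∀ {A : Set} xs → ΣL {A} (λ _ → 0#) xs ≈ 0#
ΣL-zero []       = ≈-refl
ΣL-zero (x ∷ xs) = ≈-trans (+-identityˡ (ΣL (λ _ → 0#) xs)) (ΣL-zero xs)

ΣL-swap : ∀ {A B : Set} (F : A → B → FPS) xs ys →
          ΣL (λ a → ΣL (F a) ys) xs ≈ ΣL (λ b → ΣL (λ a → F a b) xs) ys
ΣL-swap F []       ys = ≈-sym (ΣL-zero ys)
ΣL-swap F (x ∷ xs) ys =
  ≈-trans (+-cong (≈-refl {ΣL (F x) ys}) (ΣL-swap F xs ys)) (≈-sym (ΣL-+ (F x) (λ b → ΣL (λ a → F a b) xs) ys))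

range-≤ : ∀ lo N → lo ℕ.≤ N → range lo N ≡ lo ∷ range (suc lo) N
range-≤ lo N lo≤N = begin
  map (lo ℕ.+_) (upTo (suc N ∸ lo))
    ≡⟨ cong (λ d → map (lo ℕ.+_) (upTo d)) (NP.+-∸-assoc 1 lo≤N) ⟩
  map (lo ℕ.+_) (upTo (suc (N ∸ lo)))
    ≡⟨ cong₂ _∷_ (NP.+-identityʳ lo) (begin
         map (lo ℕ.+_) (applyUpTo suc (N ∸ lo))
           ≡⟨ LP.map-applyUpTo suc (lo ℕ.+_) (N ∸ lo) ⟩
         applyUpTo (λ i → lo ℕ.+ suc i) (N ∸ lo)
           ≡⟨ applyUpTo-cong (N ∸ lo) (λ i → NP.+-suc lo i) ⟩
         applyUpTo (suc lo ℕ.+_) (N ∸ lo)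
           ≡⟨ LP.map-applyUpTo (λ i → i) (suc lo ℕ.+_) (N ∸ lo) ⟨
         map (suc lo ℕ.+_) (upTo (N ∸ lo)) ∎) ⟩
  lo ∷ map (suc lo ℕ.+_) (upTo (N ∸ lo)) ∎
  where
  open ≡-Reasoning
  applyUpTo-cong : ∀ {f g : ℕ → ℕ} d → (∀ i → f i ≡ g i) → applyUpTo f d ≡ applyUpTo g d
  applyUpTo-cong zero    f≗g = refl
  applyUpTo-cong (suc d) f≗g = cong₂ _∷_ (f≗g 0) (applyUpTo-cong d (λ i → f≗g (suc i)))

range-> : ∀ lo N → N ℕ.< lo → range lo N ≡ []
range-> lo N N<lo = cong (λ d → map (lo ℕ.+_) (upTo d)) (NP.m≤n⇒m∸n≡0 N<lo)

range-ind : ∀ N (P : ℕ → Set) → (∀ lo → N ℕ.< lo → P lo) →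
            (∀ lo → lo ℕ.≤ N → P (suc lo) → P lo) → ∀ lo → P lo
range-ind N P empty step lo = go (suc N ∸ lo) lo refl
  where
  go : ∀ d lo → d ≡ suc N ∸ lo → P lo
  go zero    lo d≡ = empty lo (NP.m∸n≡0⇒m≤n (sym d≡))
  go (suc d) lo d≡ with lo ℕ.≤? N
  ... | no lo≰N = empty lo (NP.≰⇒> lo≰N)
  ... | yes lo≤N = step lo lo≤N (go d (suc lo) (NP.suc-injective (trans d≡ (NP.+-∸-assoc 1 lo≤N))))

range-bounds : ∀ N lo → All (λ j → lo ℕ.≤ j × j ℕ.≤ N) (range lo N)
range-bounds N = range-ind N (λ lo → All (λ j → lo ℕ.≤ j × j ℕ.≤ N) (range lo N))
  (λ lo N<lo → subst (All _) (sym (range-> lo N N<lo)) [])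
  (λ lo lo≤N bounds → subst (All _) (sym (range-≤ lo N lo≤N))
     ((NP.≤-refl , lo≤N) ∷ All.map (λ { (lo<j , j≤N) → NP.≤-trans (NP.n≤1+n lo) lo<j , j≤N }) bounds))

ΣL-range-cong : ∀ {h h′ : ℕ → FPS} lo N → (∀ n → lo ℕ.≤ n → n ℕ.≤ N → h n ≈ h′ n) →
                ΣL h (range lo N) ≈ ΣL h′ (range lo N)
ΣL-range-cong lo N h≈h′ =
  ΣL-congAll (All.map (λ { (lo≤n , n≤N) → h≈h′ _ lo≤n n≤N }) (range-bounds N lo))

telescope : ∀ (U : ℕ → FPS) N lo → lo ℕ.≤ suc N →
            ΣL (λ j → U j - U (suc j)) (range lo N) ≈ U lo - U (suc N)
telescope U N = range-ind N (λ lo → lo ℕ.≤ suc N → Tele lo) empty step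
  where
  Tele : ℕ → Set
  Tele lo = ΣL (λ j → U j - U (suc j)) (range lo N) ≈ U lo - U (suc N)
  empty : ∀ lo → N ℕ.< lo → lo ℕ.≤ suc N → Tele lo
  empty lo N<lo lo≤1+N rewrite range-> lo N N<lo | NP.≤-antisym lo≤1+N N<lo =
    ≈-sym (-‿inverseʳ (U (suc N)))
  step : ∀ lo → lo ℕ.≤ N → (suc lo ℕ.≤ suc N → Tele (suc lo)) → lo ℕ.≤ suc N → Tele lo
  step lo lo≤N tele _ rewrite range-≤ lo N lo≤N =
    ≈-trans (+-cong (≈-refl {U lo - U (suc lo)}) (tele (s≤s lo≤N)))
            (cancel (U lo) (U (suc lo)) (U (suc N)))
    where
    cancel : ∀ a b c → (a - b) + (b - c) ≈ a - c
    cancel = solve 3 (λ a b c → (a :- b) :+ (b :- c) := a :- c) ≈-refl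

abel-summation : ∀ (G Y : ℕ → FPS) N m →
  ΣL (λ n → (G n - G (n ∸ 1)) * ΣL Y (range n N)) (range m N) ≈
  ΣL (λ n′ → (G n′ - G (m ∸ 1)) * Y n′) (range m N)
abel-summation G Y N = range-ind N Abel empty step
  where
  ∇ : ℕ → FPS
  ∇ n = G n - G (n ∸ 1)
  Abel : ℕ → Set
  Abel m = ΣL (λ n → ∇ n * ΣL Y (range n N)) (range m N) ≈
           ΣL (λ n′ → (G n′ - G (m ∸ 1)) * Y n′) (range m N)
  empty : ∀ m → N ℕ.< m → Abel m
  empty m N<m rewrite range-> m N N<m = ≈-refl
  step : ∀ m → m ℕ.≤ N → Abel (suc m) → Abel m
  step m m≤N abel = begin
    ΣL (λ n → ∇ n * ΣL Y (range n N)) (range m N)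
      ≈⟨ ≡⇒≈ (cong (ΣL (λ n → ∇ n * ΣL Y (range n N))) (range-≤ m N m≤N)) ⟩
    ∇ m * ΣL Y (range m N) + ΣL (λ n → ∇ n * ΣL Y (range n N)) R
      ≈⟨ +-cong (*-cong (≈-refl {∇ m}) (≡⇒≈ (cong (ΣL Y) (range-≤ m N m≤N)))) abel ⟩
    ∇ m * (Y m + ΣL Y R) + ΣL (λ n′ → (G n′ - G m) * Y n′) R
      ≈⟨ +-cong (distribˡ (∇ m) (Y m) (ΣL Y R)) (≈-refl {ΣL (λ n′ → (G n′ - G m) * Y n′) R}) ⟩
    (∇ m * Y m + ∇ m * ΣL Y R) + ΣL (λ n′ → (G n′ - G m) * Y n′) R
      ≈⟨ +-assoc (∇ m * Y m) _ _ ⟩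
    ∇ m * Y m + (∇ m * ΣL Y R + ΣL (λ n′ → (G n′ - G m) * Y n′) R)
      ≈⟨ +-cong (≈-refl {∇ m * Y m}) (+-cong (ΣL-*ˡ (∇ m) Y R) (≈-refl {ΣL (λ n′ → (G n′ - G m) * Y n′) R})) ⟩
    ∇ m * Y m + (ΣL (λ n′ → ∇ m * Y n′) R + ΣL (λ n′ → (G n′ - G m) * Y n′) R)
      ≈⟨ +-cong (≈-refl {∇ m * Y m}) (≈-sym (ΣL-+ (λ n′ → ∇ m * Y n′) (λ n′ → (G n′ - G m) * Y n′) R)) ⟩
    ∇ m * Y m + ΣL (λ n′ → ∇ m * Y n′ + (G n′ - G m) * Y n′) R
      ≈⟨ +-cong (≈-refl {∇ m * Y m}) (ΣL-cong R (λ n′ → merge (G n′) (G m) (G (m ∸ 1)) (Y n′))) ⟩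
    ∇ m * Y m + ΣL (λ n′ → (G n′ - G (m ∸ 1)) * Y n′) R
      ≈⟨ ≡⇒≈ (cong (ΣL (λ n′ → (G n′ - G (m ∸ 1)) * Y n′)) (range-≤ m N m≤N)) ⟨
    ΣL (λ n′ → (G n′ - G (m ∸ 1)) * Y n′) (range m N) ∎
    where
    open SetoidReasoning FPS-setoid
    R = range (suc m) N
    merge : ∀ g gm gm′ y → (gm - gm′) * y + (g - gm) * y ≈ (g - gm′) * y
    merge = solve 4 (λ g gm gm′ y → (gm :- gm′) :* y :+ (g :- gm) :* y := (g :- gm′) :* y) ≈-refl

-- Step (3): sums over chains 1 ≤ n₁ ≤ … ≤ n_k ≤ N, for a fixed truncation level N.

module Chains (N : ℕ) where

  chains-unfold : ∀ (h : List ℕ → FPS) k lo →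
    ΣL h (chains (suc k) lo N) ≈ ΣL (λ n → ΣL (λ c → h (n ∷ c)) (chains k n N)) (range lo N)
  chains-unfold h k lo =
    ≈-trans (ΣL-concatMap h (λ n → map (n ∷_) (chains k n N)) (range lo N))
            (ΣL-cong (range lo N) (λ n → ≡⇒≈ (ΣL-map h (n ∷_) (chains k n N))))

  tails : ℕ → ℕ → FPS
  tails k n = ΣL rhsTerm (chains k n N)

  tails-suc : ∀ k n → tails (suc k) n ≈ ΣL (λ n′ → qFactor n′ * tails k n′) (range n N)
  tails-suc k n = ≈-trans (chains-unfold rhsTerm k n)
    (ΣL-cong (range n N) (λ n′ → ≈-sym (ΣL-*ˡ (qFactor n′) rhsTerm (chains k n′ N))))

  first : List ℕ → ℕ
  first []      = N
  first (n ∷ _) = n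

  chainSum : ℕ → (ℕ → FPS) → FPS
  chainSum k f = ΣL (λ c → f (first c) * rhsTerm c) (chains k 1 N)

  chainSum-suc : ∀ k f → chainSum (suc k) f ≈ ΣL (λ n → (f n * qFactor n) * tails k n) (range 1 N)
  chainSum-suc k f = ≈-trans (chains-unfold (λ c → f (first c) * rhsTerm c) k 1)
    (ΣL-cong (range 1 N) (λ n → ≈-trans
      (ΣL-cong (chains k n N) (λ c → ≈-sym (*-assoc (f n) (qFactor n) (rhsTerm c))))
      (≈-sym (ΣL-*ˡ (f n * qFactor n) rhsTerm (chains k n N)))))

  -- For k = 0 this is telescoping, for k ≥ 1 it is Abel summation.
  chainSum-abel : ∀ k f → f 0 ≈ 0# →
    chainSum k f ≈ ΣL (λ n → (f n - f (n ∸ 1)) * tails k n) (range 1 N)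
  chainSum-abel zero f f0≈0 = begin
    f N * oneF + 0#
      ≈⟨ *-identityʳ+0 (f N) ⟩
    f N
      ≈⟨ drop-f0 (f N) (f 0) f0≈0 ⟩
    (- f 0) - (- f N)
      ≈⟨ telescope (λ n → - f (n ∸ 1)) N 1 (s≤s z≤n) ⟨
    ΣL (λ n → (- f (n ∸ 1)) - (- f n)) (range 1 N)
      ≈⟨ ΣL-cong (range 1 N) (λ n → difference (f n) (f (n ∸ 1))) ⟩
    ΣL (λ n → (f n - f (n ∸ 1)) * (oneF + 0#)) (range 1 N) ∎
    where
    open SetoidReasoning FPS-setoid
    *-identityʳ+0 : ∀ x → x * 1# + 0# ≈ x
    *-identityʳ+0 = solve 1 (λ x → x :* con 1ℤ :+ con 0ℤ := x) ≈-refl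
    drop-f0 : ∀ x z → z ≈ 0# → x ≈ (- z) - (- x)
    drop-f0 x z z≈0 = ≈-trans (shape x) (+-cong (-‿cong (≈-sym z≈0)) (≈-refl { - (- x)}))
      where
      shape : ∀ x → x ≈ (- 0#) - (- x)
      shape = solve 1 (λ x → x := (:- con 0ℤ) :- (:- x)) ≈-refl
    difference : ∀ a b → (- b) - (- a) ≈ (a - b) * (1# + 0#)
    difference = solve 2 (λ a b → (:- b) :- (:- a) := (a :- b) :* (con 1ℤ :+ con 0ℤ)) ≈-refl
  chainSum-abel (suc k) f f0≈0 = begin
    chainSum (suc k) f
      ≈⟨ chainSum-suc k f ⟩
    ΣL (λ n → (f n * qFactor n) * tails k n) (range 1 N)
      ≈⟨ ΣL-cong (range 1 N) (λ n → subtract-f0 (f n) (qFactor n) (tails k n)) ⟩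
    ΣL (λ n → (f n - f 0) * (qFactor n * tails k n)) (range 1 N)
      ≈⟨ abel-summation f (λ n → qFactor n * tails k n) N 1 ⟨
    ΣL (λ n → (f n - f (n ∸ 1)) * ΣL (λ n′ → qFactor n′ * tails k n′) (range n N)) (range 1 N)
      ≈⟨ ΣL-cong (range 1 N) (λ n → *-cong (≈-refl {f n - f (n ∸ 1)}) (≈-sym (tails-suc k n))) ⟩
    ΣL (λ n → (f n - f (n ∸ 1)) * tails (suc k) n) (range 1 N) ∎
    where
    open SetoidReasoning FPS-setoid
    reassoc : ∀ x q t → (x * q) * t ≈ (x - 0#) * (q * t)
    reassoc = solve 3 (λ x q t → (x :* q) :* t := (x :- con 0ℤ) :* (q :* t)) ≈-refl
    subtract-f0 : ∀ x q t → (x * q) * t ≈ (x - f 0) * (q * t)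
    subtract-f0 x q t = ≈-trans (reassoc x q t)
      (*-cong (+-cong (≈-refl {x}) (-‿cong (≈-sym f0≈0))) (≈-refl {q * t}))

  chainSum-power : ∀ (f : ℕ → FPS) (a : FPS) → f 0 ≈ 0# →
    (∀ n → f n * qFactor n ≈ a * (f n - f (n ∸ 1))) →
    ∀ k → chainSum k f ≈ powF a k * f N
  chainSum-power f a f0≈0 recurrence zero = begin
    f N * oneF + 0# ≈⟨ identities (f N) ⟩
    oneF * f N      ∎
    where
    open SetoidReasoning FPS-setoid
    identities : ∀ x → x * 1# + 0# ≈ 1# * x
    identities = solve 1 (λ x → x :* con 1ℤ :+ con 0ℤ := con 1ℤ :* x) ≈-refl
  chainSum-power f a f0≈0 recurrence (suc k) = begin
    chainSum (suc k) f
      ≈⟨ chainSum-suc k f ⟩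
    ΣL (λ n → (f n * qFactor n) * tails k n) (range 1 N)
      ≈⟨ ΣL-cong (range 1 N) (λ n → *-cong (recurrence n) (≈-refl {tails k n})) ⟩
    ΣL (λ n → (a * (f n - f (n ∸ 1))) * tails k n) (range 1 N)
      ≈⟨ ΣL-cong (range 1 N) (λ n → *-assoc a (f n - f (n ∸ 1)) (tails k n)) ⟩
    ΣL (λ n → a * ((f n - f (n ∸ 1)) * tails k n)) (range 1 N)
      ≈⟨ ΣL-*ˡ a (λ n → (f n - f (n ∸ 1)) * tails k n) (range 1 N) ⟨
    a * ΣL (λ n → (f n - f (n ∸ 1)) * tails k n) (range 1 N)
      ≈⟨ *-cong (≈-refl {a}) (chainSum-abel k f f0≈0) ⟨
    a * chainSum k f
      ≈⟨ *-cong (≈-refl {a}) (chainSum-power f a f0≈0 recurrence k) ⟩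
    a * (powF a k * f N)
      ≈⟨ *-assoc a (powF a k) (f N) ⟨
    powF a (suc k) * f N ∎
    where open SetoidReasoning FPS-setoid

  chainSum-cong : ∀ k {f g : ℕ → FPS} → (∀ n → 1 ℕ.≤ n → n ℕ.≤ N → f n ≈ g n) →
                  chainSum (suc k) f ≈ chainSum (suc k) g
  chainSum-cong k {f} {g} f≈g = begin
    chainSum (suc k) f
      ≈⟨ chains-unfold (λ c → f (first c) * rhsTerm c) k 1 ⟩
    ΣL (λ n → ΣL (λ c → f n * rhsTerm (n ∷ c)) (chains k n N)) (range 1 N)
      ≈⟨ ΣL-range-cong 1 N (λ n 1≤n n≤N →
           ΣL-cong (chains k n N) (λ c → *-cong (f≈g n 1≤n n≤N) (≈-refl {rhsTerm (n ∷ c)}))) ⟩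
    ΣL (λ n → ΣL (λ c → g n * rhsTerm (n ∷ c)) (chains k n N)) (range 1 N)
      ≈⟨ chains-unfold (λ c → g (first c) * rhsTerm c) k 1 ⟨
    chainSum (suc k) g ∎
    where open SetoidReasoning FPS-setoid

  chainSum-+ : ∀ k f g → chainSum k (λ n → f n + g n) ≈ chainSum k f + chainSum k g
  chainSum-+ k f g = ≈-trans
    (ΣL-cong (chains k 1 N) (λ c → distribʳ (rhsTerm c) (f (first c)) (g (first c))))
    (ΣL-+ (λ c → f (first c) * rhsTerm c) (λ c → g (first c) * rhsTerm c) (chains k 1 N))

  chainSum-ΣL : ∀ {A : Set} k (w : A → FPS) (F : A → ℕ → FPS) xs →
    chainSum k (λ n → ΣL (λ a → w a * F a n) xs) ≈ ΣL (λ a → w a * chainSum k (F a)) xs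
  chainSum-ΣL k w F xs = begin
    ΣL (λ c → ΣL (λ a → w a * F a (first c)) xs * rhsTerm c) (chains k 1 N)
      ≈⟨ ΣL-cong (chains k 1 N) (λ c → ΣL-*ʳ (rhsTerm c) (λ a → w a * F a (first c)) xs) ⟩
    ΣL (λ c → ΣL (λ a → (w a * F a (first c)) * rhsTerm c) xs) (chains k 1 N)
      ≈⟨ ΣL-swap (λ c a → (w a * F a (first c)) * rhsTerm c) (chains k 1 N) xs ⟩
    ΣL (λ a → ΣL (λ c → (w a * F a (first c)) * rhsTerm c) (chains k 1 N)) xs
      ≈⟨ ΣL-cong xs (λ a → ≈-trans
           (ΣL-cong (chains k 1 N) (λ c → *-assoc (w a) (F a (first c)) (rhsTerm c)))
           (≈-sym (ΣL-*ˡ (w a) (λ c → F a (first c) * rhsTerm c) (chains k 1 N)))) ⟩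
    ΣL (λ a → w a * chainSum k (F a)) xs ∎
    where open SetoidReasoning FPS-setoid

  chainSum-one : ∀ k → chainSum k (λ _ → 1#) ≈ ΣL rhsTerm (chains k 1 N)
  chainSum-one k = ΣL-cong (chains k 1 N) (λ c → *-identityˡ (rhsTerm c))

prodL-snoc : ∀ (g : ℕ → FPS) n → prodL (map g (upTo (suc n))) ≈ prodL (map g (upTo n)) * g n
prodL-snoc g n = begin
  prodL (map g (upTo (suc n)))
    ≡⟨ cong (λ L → prodL (map g L)) (sym (LP.applyUpTo-∷ʳ (λ i → i) n)) ⟩
  prodL (map g (upTo n ++ [ n ]))
    ≡⟨ cong prodL (LP.map-++ g (upTo n) [ n ]) ⟩
  prodL (map g (upTo n) ++ [ g n ])
    ≈⟨ prodL-++ (map g (upTo n)) [ g n ] ⟩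
  prodL (map g (upTo n)) * (g n * 1#)
    ≈⟨ *-cong (≈-refl {prodL (map g (upTo n))}) (*-identityʳ (g n)) ⟩
  prodL (map g (upTo n)) * g n ∎
  where
  open SetoidReasoning FPS-setoid
  prodL-++ : ∀ xs ys → prodL (xs ++ ys) ≈ prodL xs * prodL ys
  prodL-++ []       ys = ≈-sym (*-identityˡ (prodL ys))
  prodL-++ (x ∷ xs) ys = ≈-trans (*-cong (≈-refl {x}) (prodL-++ xs ys)) (≈-sym (*-assoc x (prodL xs) (prodL ys)))

pochQ invPochQ : ℕ → FPS
pochQ    n = poch 1 1 n
invPochQ n = invPoch 1 1 n

pochQ-suc : ∀ n → pochQ (suc n) ≈ pochQ n * (1# - mono (suc n))
pochQ-suc n = ≈-trans (prodL-snoc (λ j → oneMinusQ (1 ℕ.+ 1 ℕ.* j)) n)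
  (*-cong (≈-refl {pochQ n}) (≈-trans (≡⇒≈ (cong oneMinusQ (cong suc (NP.*-identityˡ n)))) (oneMinusQ≈ (suc n))))

invPochQ-suc : ∀ n → invPochQ (suc n) ≈ invPochQ n * geom (suc n)
invPochQ-suc n = ≈-trans (prodL-snoc (λ j → geom (1 ℕ.+ 1 ℕ.* j)) n)
  (*-cong (≈-refl {invPochQ n}) (≡⇒≈ (cong geom (cong suc (NP.*-identityˡ n)))))

invPoch22-suc : ∀ n → invPoch 2 2 (suc n) ≈ invPoch 2 2 n * geom (2 ℕ.+ 2 ℕ.* n)
invPoch22-suc n = prodL-snoc (λ j → geom (2 ℕ.+ 2 ℕ.* j)) n

pochQ-inverse : ∀ n → pochQ n * invPochQ n ≈ 1#
pochQ-inverse zero    = *-identityˡ 1#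
pochQ-inverse (suc n) = begin
  pochQ (suc n) * invPochQ (suc n)
    ≈⟨ *-cong (pochQ-suc n) (invPochQ-suc n) ⟩
  (pochQ n * (1# - mono (suc n))) * (invPochQ n * geom (suc n))
    ≈⟨ regroup (pochQ n) (1# - mono (suc n)) (invPochQ n) (geom (suc n)) ⟩
  (pochQ n * invPochQ n) * (geom (suc n) * (1# - mono (suc n)))
    ≈⟨ *-cong (pochQ-inverse n) (geom-inverse (suc n) (s≤s z≤n)) ⟩
  1# * 1#
    ≈⟨ *-identityˡ 1# ⟩
  1# ∎
  where
  open SetoidReasoning FPS-setoid
  regroup : ∀ p o i g → (p * o) * (i * g) ≈ (p * i) * (g * o)
  regroup = solve 4 (λ p o i g → (p :* o) :* (i :* g) := (p :* i) :* (g :* o)) ≈-refl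

-- (q;q)_{m+d} ≡ (q;q)_m  (mod q^{m+1}), since the extra factors are 1 - q^{>m}.
pochQ-congruence : ∀ m d → OrderAtLeast (suc m) (pochQ (m ℕ.+ d) - pochQ m)
pochQ-congruence m zero = order-cong (≈-sym cancel) (λ i _ → refl)
  where
  cancel : pochQ (m ℕ.+ 0) - pochQ m ≈ 0#
  cancel = ≈-trans (+-cong (≡⇒≈ (cong pochQ (NP.+-identityʳ m))) (≈-refl { - pochQ m}))
                   (-‿inverseʳ (pochQ m))
pochQ-congruence m (suc d) = order-cong (≈-sym split) order-split
  where
  X = pochQ (m ℕ.+ d)
  e = suc (m ℕ.+ d)
  identity : ∀ x p y → x * (1# - y) - p ≈ x * (- y) + (x - p)
  identity = solve 3 (λ x p y → x :* (con 1ℤ :- y) :- p := x :* (:- y) :+ (x :- p)) ≈-refl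
  split : pochQ (m ℕ.+ suc d) - pochQ m ≈ X * (- mono e) + (X - pochQ m)
  split = ≈-trans (+-cong (≈-trans (≡⇒≈ (cong pochQ (NP.+-suc m d))) (pochQ-suc (m ℕ.+ d)))
                          (≈-refl { - pochQ m}))
                  (identity X (pochQ m) (mono e))
  order-split : OrderAtLeast (suc m) (X * (- mono e) + (X - pochQ m))
  order-split = order-+ (order-weaken (s≤s (NP.m≤m+n m d)) (order-*ʳ X (order-neg (order-mono e))))
                        (pochQ-congruence m d)

-- Step (1): the expansion of 1/(q²;q²)_n.
-- For n ≤ M,
--   1/(q²;q²)_n = Σ_{|j| ≤ n} (-1)^j q^{j²} / ((q;q)_{n-j} (q;q)_{n+j}),
-- proved by induction on n: the right-hand side S(n) satisfies
-- (1 - q^{2n+2}) S(n+1) = S(n), because each j-term of the difference is a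
-- difference  C(n,j) - C(n,j+1)  of a certificate C, and these telescope.

pairInv : ℕ → ℕ → FPS
pairInv j n = if does (j ℕ.≤? n) then invPochQ (n ∸ j) * invPochQ (n ℕ.+ j) else 0#

pairInv-≤ : ∀ j n → j ℕ.≤ n → pairInv j n ≈ invPochQ (n ∸ j) * invPochQ (n ℕ.+ j)
pairInv-≤ j n j≤n = ≡⇒≈ (if-yes (j ℕ.≤? n) _ 0# j≤n)

pairInv-> : ∀ j n → n ℕ.< j → pairInv j n ≈ 0#
pairInv-> j n n<j = ≡⇒≈ (if-no (j ℕ.≤? n) (invPochQ (n ∸ j) * invPochQ (n ℕ.+ j)) _ (NP.<⇒≱ n<j))

signedSquare : ℕ → FPS
signedSquare j = scal (-1ℤ ℤ.^ j) (mono (j ℕ.* j))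

signedSquare-suc : ∀ j d b → suc j ℕ.* suc j ℕ.+ d ≡ j ℕ.* j ℕ.+ b →
                   signedSquare (suc j) * mono d ≈ - (signedSquare j * mono b)
signedSquare-suc j d b exponents = mk (λ N → begin
  (scal (-1ℤ ℤ.* s) (mono (suc j ℕ.* suc j)) ⊗ mono d) N
    ≡⟨ scal-⊗ˡ (-1ℤ ℤ.* s) (mono (suc j ℕ.* suc j)) (mono d) N ⟩
  (-1ℤ ℤ.* s) ℤ.* (mono (suc j ℕ.* suc j) ⊗ mono d) N
    ≡⟨ cong ((-1ℤ ℤ.* s) ℤ.*_) (get shift N) ⟩
  (-1ℤ ℤ.* s) ℤ.* (mono (j ℕ.* j) ⊗ mono b) N
    ≡⟨ trans (ZP.*-assoc -1ℤ s _) (ZP.-1*i≡-i _) ⟩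
  ℤ.- (s ℤ.* (mono (j ℕ.* j) ⊗ mono b) N)
    ≡⟨ cong ℤ.-_ (scal-⊗ˡ s (mono (j ℕ.* j)) (mono b) N) ⟨
  ℤ.- (scal s (mono (j ℕ.* j)) ⊗ mono b) N ∎)
  where
  open ≡-Reasoning
  s = -1ℤ ℤ.^ j
  shift : mono (suc j ℕ.* suc j) * mono d ≈ mono (j ℕ.* j) * mono b
  shift = ≈-trans (mono-+ _ d) (≈-trans (≡⇒≈ (cong mono exponents)) (≈-sym (mono-+ _ b)))

certificate : ℕ → ℕ → FPS
certificate n j =
  if does (j ℕ.≤? suc n)
  then signedSquare j * mono (suc n ∸ j) * invPochQ (suc n ∸ j) * invPochQ (n ℕ.+ j)
  else 0#

certificate-≤ : ∀ n j → j ℕ.≤ suc n →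
  certificate n j ≈ signedSquare j * mono (suc n ∸ j) * invPochQ (suc n ∸ j) * invPochQ (n ℕ.+ j)
certificate-≤ n j j≤1+n = ≡⇒≈ (if-yes (j ℕ.≤? suc n) _ 0# j≤1+n)

certificate-> : ∀ n j → suc n ℕ.< j → certificate n j ≈ 0#
certificate-> n j 1+n<j = ≡⇒≈ (if-no (j ℕ.≤? suc n)
  (signedSquare j * mono (suc n ∸ j) * invPochQ (suc n ∸ j) * invPochQ (n ℕ.+ j)) _ (NP.<⇒≱ 1+n<j))

oneMinusQ-split : ∀ m a b → m ≡ a ℕ.+ b → oneMinusQ m ≈ 1# - mono a * mono b
oneMinusQ-split m a b m≡a+b =
  ≈-trans (oneMinusQ≈ m) (+-cong (≈-refl {1#}) (-‿cong (mono-split a b m m≡a+b)))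

partial-fractions : ∀ A B gA gB → gA * (1# - A) ≈ 1# → gB * (1# - B) ≈ 1# →
  (1# - A * B) * (gA * gB) - 1# ≈ A * gA + B * gB
partial-fractions A B gA gB invA invB = begin
  (1# - A * B) * (gA * gB) - 1#
    ≈⟨ expand A B gA gB ⟩
  (A * gA + B * gB) + ((gA * (1# - A)) * (gB * (1# - B)) - 1#
     + A * gA * (gB * (1# - B) - 1#) + B * gB * (gA * (1# - A) - 1#))
    ≈⟨ +-cong (≈-refl {A * gA + B * gB})
         (+-cong (+-cong (+-cong (*-cong invA invB) (≈-refl { - 1#}))
                         (*-cong (≈-refl {A * gA}) (+-cong invB (≈-refl { - 1#}))))
                 (*-cong (≈-refl {B * gB}) (+-cong invA (≈-refl { - 1#})))) ⟩
  (A * gA + B * gB) + (1# * 1# - 1# + A * gA * (1# - 1#) + B * gB * (1# - 1#))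
    ≈⟨ collapse A B gA gB ⟩
  A * gA + B * gB ∎
  where
  open SetoidReasoning FPS-setoid
  expand : ∀ A B gA gB → (1# - A * B) * (gA * gB) - 1# ≈
    (A * gA + B * gB) + ((gA * (1# - A)) * (gB * (1# - B)) - 1#
      + A * gA * (gB * (1# - B) - 1#) + B * gB * (gA * (1# - A) - 1#))
  expand = solve 4 (λ A B gA gB → (con 1ℤ :- A :* B) :* (gA :* gB) :- con 1ℤ :=
    (A :* gA :+ B :* gB) :+ ((gA :* (con 1ℤ :- A)) :* (gB :* (con 1ℤ :- B)) :- con 1ℤ
      :+ A :* gA :* (gB :* (con 1ℤ :- B) :- con 1ℤ) :+ B :* gB :* (gA :* (con 1ℤ :- A) :- con 1ℤ))) ≈-refl
  collapse : ∀ A B gA gB →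
    (A * gA + B * gB) + (1# * 1# - 1# + A * gA * (1# - 1#) + B * gB * (1# - 1#)) ≈ A * gA + B * gB
  collapse = solve 4 (λ A B gA gB →
    (A :* gA :+ B :* gB) :+ (con 1ℤ :* con 1ℤ :- con 1ℤ :+ A :* gA :* (con 1ℤ :- con 1ℤ)
      :+ B :* gB :* (con 1ℤ :- con 1ℤ)) := A :* gA :+ B :* gB) ≈-refl

-- The algebra behind one step of the recurrence, for 0 ≤ j ≤ n, with
-- A = q^{n+1-j}, B = q^{n+1+j}, P₁ = 1/(q;q)_{n-j}, P₂ = 1/(q;q)_{n+j}:
--   s ((1 - AB) (P₁/(1-A)) (P₂/(1-B)) - P₁P₂) = s A (P₁/(1-A)) P₂ + s B P₁ (P₂/(1-B)).
wz-identity : ∀ s A B P₁ P₂ gA gB → gA * (1# - A) ≈ 1# → gB * (1# - B) ≈ 1# →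
  s * ((1# - A * B) * ((P₁ * gA) * (P₂ * gB)) - P₁ * P₂) ≈
  s * A * (P₁ * gA) * P₂ - (- (s * B)) * P₁ * (P₂ * gB)
wz-identity s A B P₁ P₂ gA gB invA invB = begin
  s * ((1# - A * B) * ((P₁ * gA) * (P₂ * gB)) - P₁ * P₂)
    ≈⟨ factor s A B P₁ P₂ gA gB ⟩
  s * P₁ * P₂ * ((1# - A * B) * (gA * gB) - 1#)
    ≈⟨ *-cong (≈-refl {s * P₁ * P₂}) (partial-fractions A B gA gB invA invB) ⟩
  s * P₁ * P₂ * (A * gA + B * gB)
    ≈⟨ distribute s A B P₁ P₂ gA gB ⟩
  s * A * (P₁ * gA) * P₂ - (- (s * B)) * P₁ * (P₂ * gB) ∎
  where
  open SetoidReasoning FPS-setoid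
  factor : ∀ s A B P₁ P₂ gA gB → s * ((1# - A * B) * ((P₁ * gA) * (P₂ * gB)) - P₁ * P₂) ≈
                                s * P₁ * P₂ * ((1# - A * B) * (gA * gB) - 1#)
  factor = solve 7 (λ s A B P₁ P₂ gA gB →
    s :* ((con 1ℤ :- A :* B) :* ((P₁ :* gA) :* (P₂ :* gB)) :- P₁ :* P₂) :=
    s :* P₁ :* P₂ :* ((con 1ℤ :- A :* B) :* (gA :* gB) :- con 1ℤ)) ≈-refl
  distribute : ∀ s A B P₁ P₂ gA gB → s * P₁ * P₂ * (A * gA + B * gB) ≈
                                    s * A * (P₁ * gA) * P₂ - (- (s * B)) * P₁ * (P₂ * gB)
  distribute = solve 7 (λ s A B P₁ P₂ gA gB →
    s :* P₁ :* P₂ :* (A :* gA :+ B :* gB) :=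
    s :* A :* (P₁ :* gA) :* P₂ :- (:- (s :* B)) :* P₁ :* (P₂ :* gB)) ≈-refl

wz-step-inner : ∀ n j → j ℕ.≤ n →
  signedSquare j * (oneMinusQ (2 ℕ.+ 2 ℕ.* n) * pairInv j (suc n) - pairInv j n) ≈
  certificate n j - certificate n (suc j)
wz-step-inner n j j≤n = begin
  s * (oneMinusQ (2 ℕ.+ 2 ℕ.* n) * pairInv j (suc n) - pairInv j n)
    ≈⟨ *-cong (≈-refl {s}) (+-cong (*-cong (oneMinusQ-split _ (suc a) b double) upper)
                                  (-‿cong (pairInv-≤ j n j≤n))) ⟩
  s * ((1# - A * B) * ((P₁ * gA) * (P₂ * gB)) - P₁ * P₂)
    ≈⟨ wz-identity s A B P₁ P₂ gA gB (geom-inverse (suc a) (s≤s z≤n)) (geom-inverse b (s≤s z≤n)) ⟩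
  s * A * (P₁ * gA) * P₂ - (- (s * B)) * P₁ * (P₂ * gB)
    ≈⟨ +-cong (≈-sym certificate-j) (-‿cong (≈-sym certificate-j+1)) ⟩
  certificate n j - certificate n (suc j) ∎
  where
  open SetoidReasoning FPS-setoid
  a = n ∸ j
  b = suc (n ℕ.+ j)
  s = signedSquare j
  A = mono (suc a)
  B = mono b
  P₁ = invPochQ a
  P₂ = invPochQ (n ℕ.+ j)
  gA = geom (suc a)
  gB = geom b
  1+n-j : suc n ∸ j ≡ suc a
  1+n-j = NP.+-∸-assoc 1 j≤n
  double : 2 ℕ.+ 2 ℕ.* n ≡ suc a ℕ.+ b
  double = subst (λ m → 2 ℕ.+ 2 ℕ.* m ≡ suc (m ∸ j) ℕ.+ suc (m ℕ.+ j)) (NP.m+[n∸m]≡n j≤n)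
    (trans (poly j a) (cong (λ z → suc z ℕ.+ suc (j ℕ.+ a ℕ.+ j)) (sym (NP.m+n∸m≡n j a))))
    where
    poly : ∀ j t → 2 ℕ.+ 2 ℕ.* (j ℕ.+ t) ≡ suc t ℕ.+ suc (j ℕ.+ t ℕ.+ j)
    poly = solve-∀
  square : suc j ℕ.* suc j ℕ.+ a ≡ j ℕ.* j ℕ.+ b
  square = subst (λ m → suc j ℕ.* suc j ℕ.+ (m ∸ j) ≡ j ℕ.* j ℕ.+ suc (m ℕ.+ j)) (NP.m+[n∸m]≡n j≤n)
    (trans (cong (λ z → suc j ℕ.* suc j ℕ.+ z) (NP.m+n∸m≡n j a)) (poly j a))
    where
    poly : ∀ j t → suc j ℕ.* suc j ℕ.+ t ≡ j ℕ.* j ℕ.+ suc (j ℕ.+ t ℕ.+ j)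
    poly = solve-∀
  upper : pairInv j (suc n) ≈ (P₁ * gA) * (P₂ * gB)
  upper = ≈-trans (pairInv-≤ j (suc n) (NP.m≤n⇒m≤1+n j≤n))
    (*-cong (≈-trans (≡⇒≈ (cong invPochQ 1+n-j)) (invPochQ-suc a)) (invPochQ-suc (n ℕ.+ j)))
  certificate-j : certificate n j ≈ s * A * (P₁ * gA) * P₂
  certificate-j = ≈-trans (certificate-≤ n j (NP.m≤n⇒m≤1+n j≤n))
    (≈-trans (≡⇒≈ (cong (λ i → s * mono i * invPochQ i * P₂) 1+n-j))
             (*-cong (*-cong (≈-refl {s * A}) (invPochQ-suc a)) (≈-refl {P₂})))
  certificate-j+1 : certificate n (suc j) ≈ (- (s * B)) * P₁ * (P₂ * gB)
  certificate-j+1 = ≈-trans (certificate-≤ n (suc j) (s≤s j≤n))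
    (*-cong (*-cong (signedSquare-suc j a b square) (≈-refl {P₁}))
            (≈-trans (≡⇒≈ (cong invPochQ (NP.+-suc n j))) (invPochQ-suc (n ℕ.+ j))))

wz-step-edge : ∀ n →
  signedSquare (suc n) * (oneMinusQ (2 ℕ.+ 2 ℕ.* n) * pairInv (suc n) (suc n) - pairInv (suc n) n) ≈
  certificate n (suc n) - certificate n (suc (suc n))
wz-step-edge n = begin
  s * (oneMinusQ (2 ℕ.+ 2 ℕ.* n) * pairInv (suc n) (suc n) - pairInv (suc n) n)
    ≈⟨ *-cong (≈-refl {s}) (+-cong (*-cong factor upper) (-‿cong (pairInv-> (suc n) n (NP.n<1+n n)))) ⟩
  s * ((1# - B) * (1# * (P₂ * gB)) - 0#)
    ≈⟨ regroup s B P₂ gB ⟩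
  s * P₂ * (gB * (1# - B))
    ≈⟨ *-cong (≈-refl {s * P₂}) (geom-inverse b (s≤s z≤n)) ⟩
  s * P₂ * 1#
    ≈⟨ shape s P₂ ⟩
  s * 1# * 1# * P₂ - 0#
    ≈⟨ +-cong (≈-sym certificate-edge) (-‿cong (≈-sym (certificate-> n (suc (suc n)) (NP.n<1+n (suc n))))) ⟩
  certificate n (suc n) - certificate n (suc (suc n)) ∎
  where
  open SetoidReasoning FPS-setoid
  b = suc (n ℕ.+ suc n)
  s = signedSquare (suc n)
  B = mono b
  P₂ = invPochQ (n ℕ.+ suc n)
  gB = geom b
  double : ∀ n → 2 ℕ.+ 2 ℕ.* n ≡ suc (n ℕ.+ suc n)
  double = solve-∀
  factor : oneMinusQ (2 ℕ.+ 2 ℕ.* n) ≈ 1# - B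
  factor = ≈-trans (≡⇒≈ (cong oneMinusQ (double n))) (oneMinusQ≈ b)
  upper : pairInv (suc n) (suc n) ≈ 1# * (P₂ * gB)
  upper = ≈-trans (pairInv-≤ (suc n) (suc n) NP.≤-refl)
    (*-cong (≡⇒≈ (cong invPochQ (NP.n∸n≡0 n))) (invPochQ-suc (n ℕ.+ suc n)))
  certificate-edge : certificate n (suc n) ≈ s * 1# * 1# * P₂
  certificate-edge = ≈-trans (certificate-≤ n (suc n) NP.≤-refl)
    (≡⇒≈ (cong (λ i → s * mono i * invPochQ i * P₂) (NP.n∸n≡0 n)))
  regroup : ∀ s B P₂ gB → s * ((1# - B) * (1# * (P₂ * gB)) - 0#) ≈ s * P₂ * (gB * (1# - B))
  regroup = solve 4 (λ s B P₂ gB →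
    s :* ((con 1ℤ :- B) :* (con 1ℤ :* (P₂ :* gB)) :- con 0ℤ) := s :* P₂ :* (gB :* (con 1ℤ :- B))) ≈-refl
  shape : ∀ s P₂ → s * P₂ * 1# ≈ s * 1# * 1# * P₂ - 0#
  shape = solve 2 (λ s P₂ → s :* P₂ :* con 1ℤ := s :* con 1ℤ :* con 1ℤ :* P₂ :- con 0ℤ) ≈-refl

wz-step-outer : ∀ n j → suc n ℕ.< j →
  signedSquare j * (oneMinusQ (2 ℕ.+ 2 ℕ.* n) * pairInv j (suc n) - pairInv j n) ≈
  certificate n j - certificate n (suc j)
wz-step-outer n j 1+n<j = begin
  signedSquare j * (O * pairInv j (suc n) - pairInv j n)
    ≈⟨ *-cong (≈-refl {signedSquare j})
              (+-cong (*-cong (≈-refl {O}) (pairInv-> j (suc n) 1+n<j))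
                      (-‿cong (pairInv-> j n (NP.<-trans (NP.n<1+n n) 1+n<j)))) ⟩
  signedSquare j * (O * 0# - 0#)
    ≈⟨ vanish (signedSquare j) O ⟩
  0# - 0#
    ≈⟨ +-cong (≈-sym (certificate-> n j 1+n<j))
              (-‿cong (≈-sym (certificate-> n (suc j) (NP.<-trans 1+n<j (NP.n<1+n j))))) ⟩
  certificate n j - certificate n (suc j) ∎
  where
  open SetoidReasoning FPS-setoid
  O = oneMinusQ (2 ℕ.+ 2 ℕ.* n)
  vanish : ∀ s O → s * (O * 0# - 0#) ≈ 0# - 0#
  vanish = solve 2 (λ s O → s :* (O :* con 0ℤ :- con 0ℤ) := con 0ℤ :- con 0ℤ) ≈-refl

wz-step : ∀ n j →
  signedSquare j * (oneMinusQ (2 ℕ.+ 2 ℕ.* n) * pairInv j (suc n) - pairInv j n) ≈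
  certificate n j - certificate n (suc j)
wz-step n j with NP.<-cmp j (suc n)
... | tri< j<1+n _ _    = wz-step-inner n j (NP.≤-pred j<1+n)
... | tri≈ _ refl _     = wz-step-edge n
... | tri> _ _ 1+n<j    = wz-step-outer n j 1+n<j

two : FPS
two = constF (ℤ.+ 2)

-- For j = 0 the two certificates are opposite, so the step is -2 C(n,1).
wz-step-centre : ∀ n →
  oneMinusQ (2 ℕ.+ 2 ℕ.* n) * pairInv 0 (suc n) - pairInv 0 n ≈ - (two * certificate n 1)
wz-step-centre n = begin
  O * pairInv 0 (suc n) - pairInv 0 n
    ≈⟨ ≈-sym (signedSquare-zero (O * pairInv 0 (suc n) - pairInv 0 n)) ⟩
  signedSquare 0 * (O * pairInv 0 (suc n) - pairInv 0 n)
    ≈⟨ wz-step n 0 ⟩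
  certificate n 0 - certificate n 1
    ≈⟨ +-cong opposite (≈-refl { - certificate n 1}) ⟩
  - certificate n 1 - certificate n 1
    ≈⟨ twice (certificate n 1) ⟩
  - (two * certificate n 1) ∎
  where
  open SetoidReasoning FPS-setoid
  O = oneMinusQ (2 ℕ.+ 2 ℕ.* n)
  signedSquare-zero : ∀ x → signedSquare 0 * x ≈ x
  signedSquare-zero x = mk (λ N →
    trans (scal-⊗ˡ 1ℤ oneF x N) (trans (ZP.*-identityˡ _) (⊗-identityˡ x N)))
  X = signedSquare 0 * mono (suc n)
  opposite : certificate n 0 ≈ - certificate n 1
  opposite = begin
    certificate n 0
      ≈⟨ certificate-≤ n 0 z≤n ⟩
    X * invPochQ (suc n) * invPochQ (n ℕ.+ 0)
      ≈⟨ ≡⇒≈ (cong (λ i → X * invPochQ (suc n) * invPochQ i) (NP.+-identityʳ n)) ⟩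
    X * invPochQ (suc n) * invPochQ n
      ≈⟨ negate-twice X (invPochQ (suc n)) (invPochQ n) ⟩
    - ((- X) * invPochQ n * invPochQ (suc n))
      ≈⟨ -‿cong (*-cong (*-cong (≈-sym (signedSquare-suc 0 n (suc n) refl)) (≈-refl {invPochQ n}))
                        (≡⇒≈ (cong invPochQ (NP.+-comm 1 n)))) ⟩
    - (signedSquare 1 * mono n * invPochQ n * invPochQ (n ℕ.+ 1))
      ≈⟨ -‿cong (≈-sym (certificate-≤ n 1 (s≤s z≤n))) ⟩
    - certificate n 1 ∎
    where
    negate-twice : ∀ x p q → x * p * q ≈ - ((- x) * q * p)
    negate-twice = solve 3 (λ x p q → x :* p :* q := :- ((:- x) :* q :* p)) ≈-refl
  twice : ∀ x → - x - x ≈ - (two * x)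
  twice = solve 1 (λ x → :- x :- x := :- (con (ℤ.+ 2) :* x)) ≈-refl

-- The truncated right-hand side  S_M(n) = Σ_{|j| ≤ M} (-1)^j q^{j²} pairInv |j| n.
expansion : ℕ → ℕ → FPS
expansion M n = pairInv 0 n + ΣL (λ j → two * (signedSquare j * pairInv j n)) (range 1 M)

-- (1 - q^{2n+2}) S_M(n+1) = S_M(n): the j-steps telescope, and the
-- boundary term C(n,M+1) vanishes because M+1 > n+1.
expansion-recurrence : ∀ M n → suc n ℕ.≤ M →
  oneMinusQ (2 ℕ.+ 2 ℕ.* n) * expansion M (suc n) ≈ expansion M n
expansion-recurrence M n 1+n≤M = begin
  O * (pairInv 0 (suc n) + ΣL (λ j → two * (signedSquare j * pairInv j (suc n))) R)
    ≈⟨ distribˡ O (pairInv 0 (suc n)) (ΣL term′ R) ⟩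
  O * pairInv 0 (suc n) + O * ΣL (λ j → two * (signedSquare j * pairInv j (suc n))) R
    ≈⟨ +-cong (≈-refl {O * pairInv 0 (suc n)}) (ΣL-*ˡ O term′ R) ⟩
  O * pairInv 0 (suc n) + ΣL (λ j → O * (two * (signedSquare j * pairInv j (suc n)))) R
    ≈⟨ +-cong (≈-refl {O * pairInv 0 (suc n)}) (ΣL-cong R per-j) ⟩
  O * pairInv 0 (suc n) + ΣL (λ j → two * (signedSquare j * pairInv j n) + two * (C j - C (suc j))) R
    ≈⟨ +-cong (≈-refl {O * pairInv 0 (suc n)}) (ΣL-+ term (λ j → two * (C j - C (suc j))) R) ⟩
  O * pairInv 0 (suc n) + (Σ₀ + ΣL (λ j → two * (C j - C (suc j))) R)
    ≈⟨ +-cong (≈-refl {O * pairInv 0 (suc n)}) (+-cong (≈-refl {Σ₀}) (≈-sym (ΣL-*ˡ two (λ j → C j - C (suc j)) R))) ⟩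
  O * pairInv 0 (suc n) + (Σ₀ + two * ΣL (λ j → C j - C (suc j)) R)
    ≈⟨ +-cong (≈-refl {O * pairInv 0 (suc n)}) (+-cong (≈-refl {Σ₀}) (*-cong (≈-refl {two}) telescoped)) ⟩
  O * pairInv 0 (suc n) + (Σ₀ + two * (C 1 - 0#))
    ≈⟨ close (O * pairInv 0 (suc n)) (pairInv 0 n) Σ₀ (C 1) (wz-step-centre n) ⟩
  pairInv 0 n + Σ₀ ∎
  where
  open SetoidReasoning FPS-setoid
  O = oneMinusQ (2 ℕ.+ 2 ℕ.* n)
  R = range 1 M
  C = certificate n
  term term′ : ℕ → FPS
  term  j = two * (signedSquare j * pairInv j n)
  term′ j = two * (signedSquare j * pairInv j (suc n))
  Σ₀ = ΣL term R
  split : ∀ O s g′ g → O * (two * (s * g′)) ≈ two * (s * g) + two * (s * (O * g′ - g))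
  split = solve 4 (λ O s g′ g →
    O :* (con (ℤ.+ 2) :* (s :* g′)) := con (ℤ.+ 2) :* (s :* g) :+ con (ℤ.+ 2) :* (s :* (O :* g′ :- g))) ≈-refl
  per-j : ∀ j → O * (two * (signedSquare j * pairInv j (suc n))) ≈
                two * (signedSquare j * pairInv j n) + two * (C j - C (suc j))
  per-j j = ≈-trans (split O (signedSquare j) (pairInv j (suc n)) (pairInv j n))
                    (+-cong (≈-refl {two * (signedSquare j * pairInv j n)}) (*-cong (≈-refl {two}) (wz-step n j)))
  telescoped : ΣL (λ j → C j - C (suc j)) R ≈ C 1 - 0#
  telescoped = ≈-trans (telescope C M 1 (s≤s z≤n))
    (+-cong (≈-refl {C 1}) (-‿cong (certificate-> n (suc M) (s≤s 1+n≤M))))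
  close : ∀ x g S c → x - g ≈ - (two * c) → x + (S + two * (c - 0#)) ≈ g + S
  close x g S c x-g≈-2c = begin
    x + (S + two * (c - 0#))      ≈⟨ regroup x g S c ⟩
    (x - g) + (g + S + two * c)   ≈⟨ +-cong x-g≈-2c (≈-refl {g + S + two * c}) ⟩
    - (two * c) + (g + S + two * c) ≈⟨ cancel g S c ⟩
    g + S ∎
    where
    regroup : ∀ x g S c → x + (S + two * (c - 0#)) ≈ (x - g) + (g + S + two * c)
    regroup = solve 4 (λ x g S c →
      x :+ (S :+ con (ℤ.+ 2) :* (c :- con 0ℤ)) := (x :- g) :+ (g :+ S :+ con (ℤ.+ 2) :* c)) ≈-refl
    cancel : ∀ g S c → - (two * c) + (g + S + two * c) ≈ g + S
    cancel = solve 3 (λ g S c → :- (con (ℤ.+ 2) :* c) :+ (g :+ S :+ con (ℤ.+ 2) :* c) := g :+ S) ≈-refl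

invPoch22-expansion : ∀ n M → n ℕ.≤ M → invPoch 2 2 n ≈ expansion M n
invPoch22-expansion zero M _ = ≈-sym (begin
  pairInv 0 0 + ΣL (λ j → two * (signedSquare j * pairInv j 0)) (range 1 M)
    ≈⟨ +-cong (pairInv-≤ 0 0 z≤n) (ΣL-range-cong 1 M (λ j 1≤j _ →
         *-cong (≈-refl {two}) (*-cong (≈-refl {signedSquare j}) (pairInv-> j 0 1≤j)))) ⟩
  1# * 1# + ΣL (λ j → two * (signedSquare j * 0#)) (range 1 M)
    ≈⟨ +-cong (*-identityˡ 1#) (ΣL-cong (range 1 M) (λ j → vanish (signedSquare j))) ⟩
  1# + ΣL (λ _ → 0#) (range 1 M)
    ≈⟨ +-cong (≈-refl {1#}) (ΣL-zero (range 1 M)) ⟩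
  1# + 0#
    ≈⟨ +-identityʳ 1# ⟩
  1# ∎)
  where
  open SetoidReasoning FPS-setoid
  vanish : ∀ s → two * (s * 0#) ≈ 0#
  vanish = solve 1 (λ s → con (ℤ.+ 2) :* (s :* con 0ℤ) := con 0ℤ) ≈-refl
invPoch22-expansion (suc n) M 1+n≤M = begin
  invPoch 2 2 (suc n)
    ≈⟨ invPoch22-suc n ⟩
  invPoch 2 2 n * g
    ≈⟨ *-cong (invPoch22-expansion n M (NP.≤-trans (NP.n≤1+n n) 1+n≤M)) (≈-refl {g}) ⟩
  expansion M n * g
    ≈⟨ *-cong (≈-sym (expansion-recurrence M n 1+n≤M)) (≈-refl {g}) ⟩
  (O * expansion M (suc n)) * g
    ≈⟨ regroup O (expansion M (suc n)) g ⟩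
  expansion M (suc n) * (g * O)
    ≈⟨ *-cong (≈-refl {expansion M (suc n)}) (≈-trans (*-comm g O) (oneMinusQ-geom (2 ℕ.+ 2 ℕ.* n) (s≤s z≤n))) ⟩
  expansion M (suc n) * 1#
    ≈⟨ *-identityʳ (expansion M (suc n)) ⟩
  expansion M (suc n) ∎
  where
  open SetoidReasoning FPS-setoid
  g = geom (2 ℕ.+ 2 ℕ.* n)
  O = oneMinusQ (2 ℕ.+ 2 ℕ.* n)
  regroup : ∀ a b c → (a * b) * c ≈ b * (c * a)
  regroup = solve 3 (λ a b c → (a :* b) :* c := b :* (c :* a)) ≈-refl

ratio : ℕ → ℕ → FPS
ratio j n = (pochQ n * pochQ n) * pairInv j n

weight : ℕ → FPS
weight j = two * signedSquare j

lhsFactor-expansion : ∀ n M → n ℕ.≤ M →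
  poch 1 1 n * poch 1 1 n * invPoch 2 2 n ≈ 1# + ΣL (λ j → weight j * ratio j n) (range 1 M)
lhsFactor-expansion n M n≤M = begin
  (p * p) * invPoch 2 2 n
    ≈⟨ *-cong (≈-refl {p * p}) (invPoch22-expansion n M n≤M) ⟩
  (p * p) * (pairInv 0 n + ΣL (λ j → two * (signedSquare j * pairInv j n)) (range 1 M))
    ≈⟨ distribˡ (p * p) (pairInv 0 n) (ΣL term (range 1 M)) ⟩
  (p * p) * pairInv 0 n + (p * p) * ΣL (λ j → two * (signedSquare j * pairInv j n)) (range 1 M)
    ≈⟨ +-cong (*-cong (≈-refl {p * p}) (≈-trans (pairInv-≤ 0 n z≤n)
                 (≡⇒≈ (cong (λ i → invPochQ n * invPochQ i) (NP.+-identityʳ n)))))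
              (ΣL-*ˡ (p * p) term (range 1 M)) ⟩
  (p * p) * (i * i) + ΣL (λ j → (p * p) * (two * (signedSquare j * pairInv j n))) (range 1 M)
    ≈⟨ +-cong (≈-trans (interleave p i) (≈-trans (*-cong (pochQ-inverse n) (pochQ-inverse n)) (*-identityˡ 1#)))
              (ΣL-cong (range 1 M) (λ j → reassociate p (signedSquare j) (pairInv j n))) ⟩
  1# + ΣL (λ j → weight j * ratio j n) (range 1 M) ∎
  where
  open SetoidReasoning FPS-setoid
  p = pochQ n
  i = invPochQ n
  term : ℕ → FPS
  term j = two * (signedSquare j * pairInv j n)
  interleave : ∀ a b → (a * a) * (b * b) ≈ (a * b) * (a * b)
  interleave = solve 2 (λ a b → (a :* a) :* (b :* b) := (a :* b) :* (a :* b)) ≈-refl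
  reassociate : ∀ a s g → (a * a) * (two * (s * g)) ≈ (two * s) * ((a * a) * g)
  reassociate = solve 3 (λ a s g →
    (a :* a) :* (con (ℤ.+ 2) :* (s :* g)) := (con (ℤ.+ 2) :* s) :* ((a :* a) :* g)) ≈-refl

-- Step (2): the recurrence of ratio j in n.

ratio-quotient : ∀ Y Z gY gZ gB → gY * (1# - Y) ≈ 1# → gZ * (1# - Z) ≈ 1# →
  gB * (1# - Y * Z * Z) ≈ 1# →
  gZ * gZ * ((1# - Y * Z) * (1# - Y * Z) * gY * gB - 1#) ≈ Y * gY * gB
ratio-quotient Y Z gY gZ gB invY invZ invB = begin
  gZ * gZ * ((1# - Y * Z) * (1# - Y * Z) * gY * gB - 1#)
    ≈⟨ expand Y Z gY gZ gB ⟩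
  Y * gY * gB * ((gZ * (1# - Z)) * (gZ * (1# - Z))) + gZ * gZ * ((gY * (1# - Y)) * (gB * (1# - Y * Z * Z)) - 1#)
    ≈⟨ +-cong (*-cong (≈-refl {Y * gY * gB}) (*-cong invZ invZ))
              (*-cong (≈-refl {gZ * gZ}) (+-cong (*-cong invY invB) (≈-refl { - 1#}))) ⟩
  Y * gY * gB * (1# * 1#) + gZ * gZ * (1# * 1# - 1#)
    ≈⟨ collapse Y gY gB gZ ⟩
  Y * gY * gB ∎
  where
  open SetoidReasoning FPS-setoid
  expand : ∀ Y Z gY gZ gB → gZ * gZ * ((1# - Y * Z) * (1# - Y * Z) * gY * gB - 1#) ≈
    Y * gY * gB * ((gZ * (1# - Z)) * (gZ * (1# - Z))) + gZ * gZ * ((gY * (1# - Y)) * (gB * (1# - Y * Z * Z)) - 1#)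
  expand = solve 5 (λ Y Z gY gZ gB →
    gZ :* gZ :* ((con 1ℤ :- Y :* Z) :* (con 1ℤ :- Y :* Z) :* gY :* gB :- con 1ℤ) :=
    Y :* gY :* gB :* ((gZ :* (con 1ℤ :- Z)) :* (gZ :* (con 1ℤ :- Z)))
      :+ gZ :* gZ :* ((gY :* (con 1ℤ :- Y)) :* (gB :* (con 1ℤ :- Y :* Z :* Z)) :- con 1ℤ)) ≈-refl
  collapse : ∀ Y gY gB gZ → Y * gY * gB * (1# * 1#) + gZ * gZ * (1# * 1# - 1#) ≈ Y * gY * gB
  collapse = solve 4 (λ Y gY gB gZ →
    Y :* gY :* gB :* (con 1ℤ :* con 1ℤ) :+ gZ :* gZ :* (con 1ℤ :* con 1ℤ :- con 1ℤ) := Y :* gY :* gB) ≈-refl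

ratio-> : ∀ j n → n ℕ.< j → ratio j n ≈ 0#
ratio-> j n n<j = ≈-trans (*-cong (≈-refl {pochQ n * pochQ n}) (pairInv-> j n n<j)) (zeroʳ (pochQ n * pochQ n))

-- The algebra behind the recurrence for j < n, with Q = (q;q)_{n-1},
-- Y = q^{n-j}, Z = q^j, R₁ = 1/(q;q)_{n-1-j}, R₂ = 1/(q;q)_{n-1+j} and gX
-- the inverse of 1 - X:  writing F = (Q(1-YZ))² (R₁ gY)(R₂ gB) for ratio j n,
--   F · YZ gN² = Z gZ² · (F - Q² R₁ R₂).
ratio-identity : ∀ Q R₁ R₂ Y Z gY gZ gB gN →
  gY * (1# - Y) ≈ 1# → gZ * (1# - Z) ≈ 1# → gB * (1# - Y * Z * Z) ≈ 1# → gN * (1# - Y * Z) ≈ 1# →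
  (Q * (1# - Y * Z)) * (Q * (1# - Y * Z)) * ((R₁ * gY) * (R₂ * gB)) * ((Y * Z * gN) * gN) ≈
  ((Z * gZ) * gZ) * ((Q * (1# - Y * Z)) * (Q * (1# - Y * Z)) * ((R₁ * gY) * (R₂ * gB)) - (Q * Q) * (R₁ * R₂))
ratio-identity Q R₁ R₂ Y Z gY gZ gB gN invY invZ invB invN = begin
  (Q * (1# - Y * Z)) * (Q * (1# - Y * Z)) * ((R₁ * gY) * (R₂ * gB)) * ((Y * Z * gN) * gN)
    ≈⟨ isolate Q R₁ R₂ Y Z gY gB gN ⟩
  Q * Q * R₁ * R₂ * gY * gB * Y * Z * ((gN * (1# - Y * Z)) * (gN * (1# - Y * Z)))
    ≈⟨ *-cong (≈-refl {Q * Q * R₁ * R₂ * gY * gB * Y * Z}) (*-cong invN invN) ⟩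
  Q * Q * R₁ * R₂ * gY * gB * Y * Z * (1# * 1#)
    ≈⟨ gather Q R₁ R₂ Y Z gY gB ⟩
  Z * Q * Q * R₁ * R₂ * (Y * gY * gB)
    ≈⟨ *-cong (≈-refl {Z * Q * Q * R₁ * R₂}) (≈-sym (ratio-quotient Y Z gY gZ gB invY invZ invB)) ⟩
  Z * Q * Q * R₁ * R₂ * (gZ * gZ * ((1# - Y * Z) * (1# - Y * Z) * gY * gB - 1#))
    ≈⟨ spread Q R₁ R₂ Y Z gY gZ gB ⟩
  ((Z * gZ) * gZ) * ((Q * (1# - Y * Z)) * (Q * (1# - Y * Z)) * ((R₁ * gY) * (R₂ * gB)) - (Q * Q) * (R₁ * R₂)) ∎
  where
  open SetoidReasoning FPS-setoid
  isolate : ∀ Q R₁ R₂ Y Z gY gB gN →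
    (Q * (1# - Y * Z)) * (Q * (1# - Y * Z)) * ((R₁ * gY) * (R₂ * gB)) * ((Y * Z * gN) * gN) ≈
    Q * Q * R₁ * R₂ * gY * gB * Y * Z * ((gN * (1# - Y * Z)) * (gN * (1# - Y * Z)))
  isolate = solve 8 (λ Q R₁ R₂ Y Z gY gB gN →
    (Q :* (con 1ℤ :- Y :* Z)) :* (Q :* (con 1ℤ :- Y :* Z)) :* ((R₁ :* gY) :* (R₂ :* gB)) :* ((Y :* Z :* gN) :* gN) :=
    Q :* Q :* R₁ :* R₂ :* gY :* gB :* Y :* Z :* ((gN :* (con 1ℤ :- Y :* Z)) :* (gN :* (con 1ℤ :- Y :* Z)))) ≈-refl
  gather : ∀ Q R₁ R₂ Y Z gY gB →
    Q * Q * R₁ * R₂ * gY * gB * Y * Z * (1# * 1#) ≈ Z * Q * Q * R₁ * R₂ * (Y * gY * gB)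
  gather = solve 7 (λ Q R₁ R₂ Y Z gY gB →
    Q :* Q :* R₁ :* R₂ :* gY :* gB :* Y :* Z :* (con 1ℤ :* con 1ℤ) := Z :* Q :* Q :* R₁ :* R₂ :* (Y :* gY :* gB)) ≈-refl
  spread : ∀ Q R₁ R₂ Y Z gY gZ gB →
    Z * Q * Q * R₁ * R₂ * (gZ * gZ * ((1# - Y * Z) * (1# - Y * Z) * gY * gB - 1#)) ≈
    ((Z * gZ) * gZ) * ((Q * (1# - Y * Z)) * (Q * (1# - Y * Z)) * ((R₁ * gY) * (R₂ * gB)) - (Q * Q) * (R₁ * R₂))
  spread = solve 8 (λ Q R₁ R₂ Y Z gY gZ gB →
    Z :* Q :* Q :* R₁ :* R₂ :* (gZ :* gZ :* ((con 1ℤ :- Y :* Z) :* (con 1ℤ :- Y :* Z) :* gY :* gB :- con 1ℤ)) :=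
    ((Z :* gZ) :* gZ) :* ((Q :* (con 1ℤ :- Y :* Z)) :* (Q :* (con 1ℤ :- Y :* Z)) :* ((R₁ :* gY) :* (R₂ :* gB))
      :- (Q :* Q) :* (R₁ :* R₂))) ≈-refl

ratio-recurrence-inner : ∀ j n → 1 ℕ.≤ j → j ℕ.< n →
  ratio j n * qFactor n ≈ qFactor j * (ratio j n - ratio j (n ∸ 1))
ratio-recurrence-inner j (suc n) 1≤j (s≤s j≤n) = begin
  ratio j (suc n) * qFactor (suc n)
    ≈⟨ *-cong ratio-n+1 (*-cong (*-cong q^n+1 (≈-refl {gN})) (≈-refl {gN})) ⟩
  F * ((Y * Z * gN) * gN)
    ≈⟨ ratio-identity Q R₁ R₂ Y Z gY gZ gB gN (geom-inverse t (s≤s z≤n)) (geom-inverse j 1≤j) invB invN ⟩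
  qFactor j * (F - (Q * Q) * (R₁ * R₂))
    ≈⟨ *-cong (≈-refl {qFactor j}) (+-cong (≈-sym ratio-n+1)
                                          (-‿cong (*-cong (≈-refl {Q * Q}) (≈-sym (pairInv-≤ j n j≤n))))) ⟩
  qFactor j * (ratio j (suc n) - ratio j n) ∎
  where
  open SetoidReasoning FPS-setoid
  t = suc (n ∸ j)
  Y = mono t
  Z = mono j
  gY = geom t
  gZ = geom j
  gB = geom (suc (n ℕ.+ j))
  gN = geom (suc n)
  Q = pochQ n
  R₁ = invPochQ (n ∸ j)
  R₂ = invPochQ (n ℕ.+ j)
  F = (Q * (1# - Y * Z)) * (Q * (1# - Y * Z)) * ((R₁ * gY) * (R₂ * gB))
  1+n≡t+j : suc n ≡ t ℕ.+ j
  1+n≡t+j = cong suc (sym (NP.m∸n+n≡m j≤n))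
  q^n+1 : mono (suc n) ≈ Y * Z
  q^n+1 = mono-split t j (suc n) 1+n≡t+j
  q^n+j+1 : mono (suc (n ℕ.+ j)) ≈ Y * Z * Z
  q^n+j+1 = ≈-trans (mono-split (t ℕ.+ j) j _ (cong (ℕ._+ j) 1+n≡t+j)) (*-cong (mono-split t j _ refl) (≈-refl {Z}))
  invN : gN * (1# - Y * Z) ≈ 1#
  invN = ≈-trans (*-cong (≈-refl {gN}) (+-cong (≈-refl {1#}) (-‿cong (≈-sym q^n+1)))) (geom-inverse (suc n) (s≤s z≤n))
  invB : gB * (1# - Y * Z * Z) ≈ 1#
  invB = ≈-trans (*-cong (≈-refl {gB}) (+-cong (≈-refl {1#}) (-‿cong (≈-sym q^n+j+1))))
                 (geom-inverse (suc (n ℕ.+ j)) (s≤s z≤n))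
  poch-n+1 : pochQ (suc n) ≈ Q * (1# - Y * Z)
  poch-n+1 = ≈-trans (pochQ-suc n) (*-cong (≈-refl {Q}) (+-cong (≈-refl {1#}) (-‿cong q^n+1)))
  upper : pairInv j (suc n) ≈ (R₁ * gY) * (R₂ * gB)
  upper = ≈-trans (pairInv-≤ j (suc n) (NP.m≤n⇒m≤1+n j≤n))
    (*-cong (≈-trans (≡⇒≈ (cong invPochQ (NP.+-∸-assoc 1 j≤n))) (invPochQ-suc (n ∸ j))) (invPochQ-suc (n ℕ.+ j)))
  ratio-n+1 : ratio j (suc n) ≈ F
  ratio-n+1 = *-cong (*-cong poch-n+1 poch-n+1) upper

-- The recurrence for all n; for n ≤ j it holds because ratio j (n-1) vanishes
-- (and so does ratio j n when n < j).
ratio-recurrence : ∀ j → 1 ℕ.≤ j → ∀ n →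
  ratio j n * qFactor n ≈ qFactor j * (ratio j n - ratio j (n ∸ 1))
ratio-recurrence j 1≤j n with NP.<-cmp j n
... | tri< j<n _ _ = ratio-recurrence-inner j n 1≤j j<n
... | tri≈ _ refl _ = begin
  ratio j j * qFactor j                      ≈⟨ subtract-zero (ratio j j) (qFactor j) ⟩
  qFactor j * (ratio j j - 0#)               ≈⟨ *-cong (≈-refl {qFactor j}) (+-cong (≈-refl {ratio j j})
                                                  (-‿cong (≈-sym (ratio-> j (j ∸ 1) (NP.∸-monoʳ-< {j} {1} {0} (s≤s z≤n) 1≤j))))) ⟩
  qFactor j * (ratio j j - ratio j (j ∸ 1)) ∎
  where
  open SetoidReasoning FPS-setoid
  subtract-zero : ∀ r a → r * a ≈ a * (r - 0#)
  subtract-zero = solve 2 (λ r a → r :* a := a :* (r :- con 0ℤ)) ≈-refl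
... | tri> _ _ n<j = begin
  ratio j n * qFactor n             ≈⟨ *-cong (ratio-> j n n<j) (≈-refl {qFactor n}) ⟩
  0# * qFactor n                    ≈⟨ vanish (qFactor n) (qFactor j) ⟩
  qFactor j * (0# - 0#)             ≈⟨ *-cong (≈-refl {qFactor j}) (+-cong (≈-sym (ratio-> j n n<j))
                                         (-‿cong (≈-sym (ratio-> j (n ∸ 1) (NP.≤-<-trans (NP.m∸n≤m n 1) n<j))))) ⟩
  qFactor j * (ratio j n - ratio j (n ∸ 1)) ∎
  where
  open SetoidReasoning FPS-setoid
  vanish : ∀ a b → 0# * a ≈ b * (0# - 0#)
  vanish = solve 2 (λ a b → con 0ℤ :* a := b :* (con 0ℤ :- con 0ℤ)) ≈-refl

-- Step (4): the theta terms and truncation.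

open CommutativeRing FPS-ring using (semiring; commutativeSemiring)
open import Algebra.Properties.Semiring.Exp semiring using (_^_; ^-homo-*)
open import Algebra.Properties.CommutativeSemiring.Exp commutativeSemiring using (^-distrib-*)

powF≈^ : ∀ x k → powF x k ≈ x ^ k
powF≈^ x zero    = ≈-refl
powF≈^ x (suc k) = *-cong (≈-refl {x}) (powF≈^ x k)

mono-^ : ∀ j k → mono j ^ k ≈ mono (k ℕ.* j)
mono-^ j zero    = ≈-refl
mono-^ j (suc k) = ≈-trans (*-cong (≈-refl {mono j}) (mono-^ j k)) (mono-+ j (k ℕ.* j))

weight-power : ∀ j k → weight j * powF (qFactor j) k ≈ thetaTerm k j
weight-power j k = begin
  two * signedSquare j * powF (qFactor j) k
    ≈⟨ *-cong (*-cong (≈-refl {two}) (scal≈constF* s (mono (j ℕ.* j)))) power ⟩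
  two * (constF s * mono (j ℕ.* j)) * ((mono (k ℕ.* j) * G) * G)
    ≈⟨ regroup two (constF s) (mono (j ℕ.* j)) (mono (k ℕ.* j)) G ⟩
  (two * constF s) * ((mono (j ℕ.* j) * mono (k ℕ.* j)) * (G * G))
    ≈⟨ *-cong (≈-sym (ACR._-Raw-AlmostCommutative⟶_.*-homo constF-hom (ℤ.+ 2) s))
              (*-cong (mono-+ (j ℕ.* j) (k ℕ.* j)) (≈-sym double)) ⟩
  constF (ℤ.+ 2 ℤ.* s) * (mono (j ℕ.* j ℕ.+ k ℕ.* j) * powF (geom j) (2 ℕ.* k))
    ≈⟨ scal≈constF* (ℤ.+ 2 ℤ.* s) _ ⟨
  thetaTerm k j ∎
  where
  open SetoidReasoning FPS-setoid
  s = -1ℤ ℤ.^ j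
  G = geom j ^ k
  power : powF (qFactor j) k ≈ (mono (k ℕ.* j) * G) * G
  power = ≈-trans (powF≈^ (qFactor j) k)
    (≈-trans (^-distrib-* (mono j * geom j) (geom j) k)
             (*-cong (≈-trans (^-distrib-* (mono j) (geom j) k) (*-cong (mono-^ j k) (≈-refl {G}))) (≈-refl {G})))
  double : powF (geom j) (2 ℕ.* k) ≈ G * G
  double = ≈-trans (powF≈^ (geom j) (2 ℕ.* k))
    (≈-trans (≡⇒≈ (cong (geom j ^_) (cong (k ℕ.+_) (NP.+-identityʳ k)))) (^-homo-* (geom j) k k))
  regroup : ∀ c a m₁ m₂ g → c * (a * m₁) * ((m₂ * g) * g) ≈ (c * a) * ((m₁ * m₂) * (g * g))
  regroup = solve 5 (λ c a m₁ m₂ g →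
    c :* (a :* m₁) :* ((m₂ :* g) :* g) := (c :* a) :* ((m₁ :* m₂) :* (g :* g))) ≈-refl

weight-power-order : ∀ j k → OrderAtLeast (j ℕ.* j) (weight j * powF (qFactor j) k)
weight-power-order j k = order-*ˡ (powF (qFactor j) k)
  (order-*ʳ two (order-cong (≈-sym (scal≈constF* (-1ℤ ℤ.^ j) (mono (j ℕ.* j))))
    (order-*ʳ (constF (-1ℤ ℤ.^ j)) (order-mono (j ℕ.* j)))))

ratio-near-one : ∀ j N → j ℕ.≤ N → OrderAtLeast (suc (N ∸ j)) (ratio j N - 1#)
ratio-near-one j N j≤N = order-cong (≈-sym ratio-1) (order-*ʳ (p₁ * p₂) (order-+ (order-*ʳ x low) (order-*ʳ ya high)))
  where
  a = N ∸ j
  x = pochQ N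
  ya = pochQ a
  yb = pochQ (N ℕ.+ j)
  p₁ = invPochQ a
  p₂ = invPochQ (N ℕ.+ j)
  rearrange : ∀ x ya yb p₁ p₂ → (x * x) * (p₁ * p₂) - 1# ≈
    (p₁ * p₂) * (x * (x - ya) + ya * (x - yb)) + ((ya * p₁) * (yb * p₂) - 1#)
  rearrange = solve 5 (λ x ya yb p₁ p₂ → (x :* x) :* (p₁ :* p₂) :- con 1ℤ :=
    (p₁ :* p₂) :* (x :* (x :- ya) :+ ya :* (x :- yb)) :+ ((ya :* p₁) :* (yb :* p₂) :- con 1ℤ)) ≈-refl
  drop : ∀ z → z + (1# * 1# - 1#) ≈ z
  drop = solve 1 (λ z → z :+ (con 1ℤ :* con 1ℤ :- con 1ℤ) := z) ≈-refl
  ratio-1 : ratio j N - 1# ≈ (p₁ * p₂) * (x * (x - ya) + ya * (x - yb))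
  ratio-1 = ≈-trans (+-cong (*-cong (≈-refl {x * x}) (pairInv-≤ j N j≤N)) (≈-refl { - 1#}))
    (≈-trans (rearrange x ya yb p₁ p₂)
    (≈-trans (+-cong (≈-refl {(p₁ * p₂) * (x * (x - ya) + ya * (x - yb))})
                     (+-cong (*-cong (pochQ-inverse a) (pochQ-inverse (N ℕ.+ j))) (≈-refl { - 1#})))
             (drop _)))
  low : OrderAtLeast (suc a) (x - ya)
  low = order-cong (≡⇒≈ (cong (λ i → pochQ i - ya) (NP.m∸n+n≡m j≤N))) (pochQ-congruence a j)
  negate : ∀ x y → - (y - x) ≈ x - y
  negate = solve 2 (λ x y → :- (y :- x) := x :- y) ≈-refl
  high : OrderAtLeast (suc a) (x - yb)
  high = order-weaken (s≤s (NP.m∸n≤m N j)) (order-cong (negate x yb) (order-neg (pochQ-congruence N j)))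

-- The j-th correction term of the main identity agrees with the theta term
-- in the coefficient of q^N: they differ by a series of order
-- j² + (N - j + 1) > N.
theta-truncation : ∀ k j N → 1 ℕ.≤ j → j ℕ.≤ N →
  (weight j * (powF (qFactor j) k * ratio j N)) N ≡ thetaTerm k j N
theta-truncation k j N 1≤j j≤N = begin
  (weight j * (powF (qFactor j) k * ratio j N)) N
    ≡⟨ get (split (weight j) (powF (qFactor j) k) (ratio j N)) N ⟩
  E N ℤ.+ (E * (ratio j N - 1#)) N
    ≡⟨ cong (λ z → E N ℤ.+ z) (order-* (weight-power-order j k) (ratio-near-one j N j≤N) N N<order) ⟩
  E N ℤ.+ 0ℤ
    ≡⟨ ZP.+-identityʳ (E N) ⟩
  E N
    ≡⟨ get (weight-power j k) N ⟩
  thetaTerm k j N ∎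
  where
  open ≡-Reasoning
  E = weight j * powF (qFactor j) k
  split : ∀ w p r → w * (p * r) ≈ w * p + (w * p) * (r - 1#)
  split = solve 3 (λ w p r → w :* (p :* r) := w :* p :+ (w :* p) :* (r :- con 1ℤ)) ≈-refl
  j≤j*j : j ℕ.≤ j ℕ.* j
  j≤j*j = NP.m≤m*n j j {{ℕ.>-nonZero 1≤j}}
  N<order : N ℕ.< j ℕ.* j ℕ.+ suc (N ∸ j)
  N<order = subst (ℕ._< j ℕ.* j ℕ.+ suc (N ∸ j)) (NP.m+[n∸m]≡n j≤N)
    (NP.≤-trans (NP.≤-reflexive (sym (NP.+-suc j (N ∸ j)))) (NP.+-monoˡ-≤ (suc (N ∸ j)) j≤j*j))

lhsFactor : ℕ → FPS
lhsFactor n = poch 1 1 n * poch 1 1 n * invPoch 2 2 n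

main-identity : ∀ N k →
  ΣL lhsTerm (chains (suc k) 1 N) ≈
  ΣL rhsTerm (chains (suc k) 1 N) + ΣL (λ j → weight j * (powF (qFactor j) (suc k) * ratio j N)) (range 1 N)
main-identity N k = begin
  ΣL lhsTerm (chains (suc k) 1 N)
    ≈⟨ chains-unfold lhsTerm k 1 ⟩
  ΣL (λ n → ΣL (λ c → lhsTerm (n ∷ c)) (chains k n N)) R
    ≈⟨ chains-unfold (λ c → lhsFactor (first c) * rhsTerm c) k 1 ⟨
  chainSum (suc k) lhsFactor
    ≈⟨ chainSum-cong k (λ n _ n≤N → lhsFactor-expansion n N n≤N) ⟩
  chainSum (suc k) (λ n → 1# + corrections n)
    ≈⟨ chainSum-+ (suc k) (λ _ → 1#) corrections ⟩
  chainSum (suc k) (λ _ → 1#) + chainSum (suc k) corrections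
    ≈⟨ +-cong (chainSum-one (suc k)) (chainSum-ΣL (suc k) weight ratio R) ⟩
  ΣL rhsTerm (chains (suc k) 1 N) + ΣL (λ j → weight j * chainSum (suc k) (ratio j)) R
    ≈⟨ +-cong (≈-refl {ΣL rhsTerm (chains (suc k) 1 N)}) (ΣL-range-cong 1 N (λ j 1≤j _ →
         *-cong (≈-refl {weight j})
                (chainSum-power (ratio j) (qFactor j) (ratio-> j 0 1≤j) (ratio-recurrence j 1≤j) (suc k)))) ⟩
  ΣL rhsTerm (chains (suc k) 1 N) + ΣL (λ j → weight j * (powF (qFactor j) (suc k) * ratio j N)) R ∎
  where
  open SetoidReasoning FPS-setoid
  open Chains N
  R = range 1 N
  corrections : ℕ → FPS
  corrections n = ΣL (λ j → weight j * ratio j n) R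

corollary2p5 : (k : ℕ) → 1 ≤ k →
    multiSum k lhsTerm ≐ multiSum k rhsTerm ⊕ infSum (thetaTerm k)
corollary2p5 (suc k) _ N = begin
  multiSum (suc k) lhsTerm N
    ≡⟨ ΣL-coefficient lhsTerm (chains (suc k) 1 N) N ⟨
  ΣL lhsTerm (chains (suc k) 1 N) N
    ≡⟨ get (main-identity N k) N ⟩
  ΣL rhsTerm (chains (suc k) 1 N) N ℤ.+ ΣL Θ (range 1 N) N
    ≡⟨ cong₂ ℤ._+_ (ΣL-coefficient rhsTerm (chains (suc k) 1 N) N) (ΣL-coefficient Θ (range 1 N) N) ⟩
  multiSum (suc k) rhsTerm N ℤ.+ sumL (map (λ j → Θ j N) (range 1 N))
    ≡⟨ cong (λ xs → multiSum (suc k) rhsTerm N ℤ.+ sumL xs) (LP.map-cong-local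
         (All.map (λ { (1≤j , j≤N) → theta-truncation (suc k) _ N 1≤j j≤N }) (range-bounds N 1))) ⟩
  multiSum (suc k) rhsTerm N ℤ.+ infSum (thetaTerm (suc k)) N ∎
  where
  open ≡-Reasoning
  Θ : ℕ → FPS
  Θ j = weight j * (powF (qFactor j) (suc k) * ratio j N)
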